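{- For every integer $n\ge 0$, $\overline{p}_3(16n+14)\equiv 0 \pmod{32}$.
   Context: An overpartition of $n$ is a partition of $n$ in which the first occurrence of each distinct part may (or may not) be overlined. An overpartition triple of $n$ is a triple of overpartitions whose parts together sum to $n$. $\overline{p}_3(n)$ denotes the number of overpartition triples of $n$, with $\overline{p}_3(0)=1$; equivalently $\sum_{n\ge0}\overline{p}_3(n)q^n=\big((-q;q)_\infty/(q;q)_\infty\big)^3$, where $(a;q)_\infty=\prod_{n\ge0}(1-aq^n)$. -}

module Defs where

open import Data.Nat using (ℕ; zero; suc; _+_; _*_; _∸_; _≤ᵇ_)
open import Data.Bool using (if_then_else_)

-- An overpartition of n with all parts ≤ k is determined by choosing, for each
-- part size p ≤ k, a multiplicity m ≥ 0 and, when m ≥ 1, whether the first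
-- occurrence of p is overlined (2 choices).

-- multSum g p fuel r = Σ_{m ≥ 1, m*p ≤ r} g (r ∸ m*p)   (fuel ≥ r suffices when p ≥ 1)
multSum : (ℕ → ℕ) → ℕ → ℕ → ℕ → ℕ
multSum g p zero    r = 0
multSum g p (suc f) r =
  if p ≤ᵇ r then g (r ∸ p) + multSum g p f (r ∸ p) else 0

-- ovBounded k n = number of overpartitions of n whose parts are all ≤ k
ovBounded : ℕ → ℕ → ℕ
ovBounded zero    zero    = 1
ovBounded zero    (suc n) = 0
ovBounded (suc k) n = ovBounded k n + 2 * multSum (ovBounded k) (suc k) n n

-- p̄(n): number of overpartitions of n (parts of an overpartition of n are ≤ n)
pbar : ℕ → ℕ
pbar n = ovBounded n n

sumTo : ℕ → (ℕ → ℕ) → ℕ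
sumTo zero    f = f 0
sumTo (suc n) f = sumTo n f + f (suc n)

pbar3 : ℕ → ℕ
pbar3 n = sumTo n (λ a → sumTo (n ∸ a) (λ b → pbar a * pbar b * pbar (n ∸ a ∸ b)))

module Submission where

-- Write P(q) = Σ p̄(n) qⁿ = (-q;q)_∞/(q;q)_∞ and φ(q) = Σ_{k∈ℤ} (-1)^k q^{k²} = 1 + 2τ with
-- τ = Σ_{k≥1} (-1)^k q^{k²}. Gauss's identity φ = (q;q)_∞/(-q;q)_∞ gives Pφ = 1, hence P³(1 + 2τ)³ = 1,
-- and expanding (1 + 2τ)⁻³ 2-adically, P³ ≡ 1 - 6τ + 24τ² - 80τ³ + 240τ⁴ (mod 32). Since 16n + 14 is not
-- of the form a², a² + b² or a² + 2b² (mod 16), the coefficients of τ and τ² at N = 16n + 14 vanish and,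
-- by f(q)² ≡ f(q²) (mod 2), those of τ³ and τ⁴ are even; so the right-hand side is 0 mod 32 at N.
--
-- Gauss's identity is obtained from
-- Rothe's q-binomial theorem in base q² at z = q^{2m+1}, which gives a finite form with Gaussian
-- binomials [2m+2, j]_{q²}; letting m → ∞ yields φ = (q;q²)_∞² (q²;q²)_∞. The overpartition counts of
-- Defs are shown to satisfy (1 - q^p) F_p = (1 + q^p) F_{p-1}, so Σ p̄(n) qⁿ · (q;q)_∞ = (-q;q)_∞.

module Proof where

  open import Defs using (multSum; ovBounded; pbar; sumTo; pbar3)

  open import Data.Nat as ℕ using (ℕ; zero; suc; _∸_; _≤_; _<_; z≤n; s≤s; _≤ᵇ_)
  import Data.Nat.Properties as ℕₚ
  open import Data.Integer as ℤ using (ℤ; +_; _+_; _*_; -_; 0ℤ; 1ℤ)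
  import Data.Integer.Properties as ℤₚ
  open import Data.Nat.Tactic.RingSolver using () renaming (solve-∀ to ℕ-solve-∀)
  open import Data.Integer.Tactic.RingSolver using (solve-∀)
  open import Data.Product using (Σ; _,_)
  open import Data.Sum using (_⊎_; inj₁; inj₂)
  open import Data.Maybe using (Maybe; just; nothing)
  open import Relation.Nullary using (yes; no)
  open import Relation.Binary.PropositionalEquality
  open import Data.Nat.Divisibility using (_∣_; divides)
  open import Data.Bool using (true; false)
  import Data.Bool as Bool
  open import Data.Unit using (tt)
  open import Data.Empty using (⊥; ⊥-elim)
  open import Algebra.Bundles using (CommutativeRing)
  open import Relation.Binary.Bundles using (Setoid)
  import Algebra.Solver.Ring.AlmostCommutativeRing as ACR
  import Relation.Binary.Reasoning.Setoid

  sumℤ : ℕ → (ℕ → ℤ) → ℤ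
  sumℤ zero    f = f 0
  sumℤ (suc n) f = sumℤ n f + f (suc n)

  sumℤ-cong : ∀ n {f g : ℕ → ℤ} → (∀ i → i ≤ n → f i ≡ g i) → sumℤ n f ≡ sumℤ n g
  sumℤ-cong zero    f≡g = f≡g 0 z≤n
  sumℤ-cong (suc n) f≡g =
    cong₂ _+_ (sumℤ-cong n (λ i i≤n → f≡g i (ℕₚ.m≤n⇒m≤1+n i≤n))) (f≡g (suc n) ℕₚ.≤-refl)

  sumℤ-zero : ∀ n (f : ℕ → ℤ) → (∀ i → i ≤ n → f i ≡ 0ℤ) → sumℤ n f ≡ 0ℤ
  sumℤ-zero zero    f f≡0 = f≡0 0 z≤n
  sumℤ-zero (suc n) f f≡0 =
    cong₂ _+_ (sumℤ-zero n f (λ i i≤n → f≡0 i (ℕₚ.m≤n⇒m≤1+n i≤n))) (f≡0 (suc n) ℕₚ.≤-refl)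

  sumℤ-+ : ∀ n (f g : ℕ → ℤ) → sumℤ n (λ i → f i + g i) ≡ sumℤ n f + sumℤ n g
  sumℤ-+ zero    f g = refl
  sumℤ-+ (suc n) f g = trans (cong (_+ (f (suc n) + g (suc n))) (sumℤ-+ n f g))
                             (interchange (sumℤ n f) (sumℤ n g) (f (suc n)) (g (suc n)))
    where
    interchange : ∀ a b c d → (a + b) + (c + d) ≡ (a + c) + (b + d)
    interchange = solve-∀

  sumℤ-*ˡ : ∀ n c (f : ℕ → ℤ) → sumℤ n (λ i → c * f i) ≡ c * sumℤ n f
  sumℤ-*ˡ zero    c f = refl
  sumℤ-*ˡ (suc n) c f = trans (cong (_+ (c * f (suc n))) (sumℤ-*ˡ n c f))
                              (sym (ℤₚ.*-distribˡ-+ c (sumℤ n f) (f (suc n))))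

  sumℤ-*ʳ : ∀ n c (f : ℕ → ℤ) → sumℤ n (λ i → f i * c) ≡ sumℤ n f * c
  sumℤ-*ʳ n c f = trans (sumℤ-cong n (λ i _ → ℤₚ.*-comm (f i) c))
                        (trans (sumℤ-*ˡ n c f) (ℤₚ.*-comm c (sumℤ n f)))

  sumℤ-neg : ∀ n (f : ℕ → ℤ) → sumℤ n (λ i → - f i) ≡ - sumℤ n f
  sumℤ-neg zero    f = refl
  sumℤ-neg (suc n) f = trans (cong (_+ (- f (suc n))) (sumℤ-neg n f))
                             (sym (ℤₚ.neg-distrib-+ (sumℤ n f) (f (suc n))))

  sumℤ-head : ∀ n (f : ℕ → ℤ) → sumℤ (suc n) f ≡ f 0 + sumℤ n (λ i → f (suc i))
  sumℤ-head zero    f = refl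
  sumℤ-head (suc n) f = trans (cong (_+ f (suc (suc n))) (sumℤ-head n f))
                              (ℤₚ.+-assoc (f 0) (sumℤ n (λ i → f (suc i))) (f (suc (suc n))))

  sumℤ-split : ∀ a b f → sumℤ (suc (a ℕ.+ b)) f ≡ sumℤ a f + sumℤ b (λ k → f (suc (a ℕ.+ k)))
  sumℤ-split a zero f rewrite ℕₚ.+-identityʳ a = refl
  sumℤ-split a (suc b) f rewrite ℕₚ.+-suc a b =
    trans (cong (_+ f (suc (suc (a ℕ.+ b)))) (sumℤ-split a b f))
          (ℤₚ.+-assoc (sumℤ a f) (sumℤ b (λ k → f (suc (a ℕ.+ k)))) _)

  sumℤ-extend : ∀ a d f → (∀ i → a < i → f i ≡ 0ℤ) → sumℤ (a ℕ.+ d) f ≡ sumℤ a f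
  sumℤ-extend a zero f _ rewrite ℕₚ.+-identityʳ a = refl
  sumℤ-extend a (suc d) f f≡0 rewrite ℕₚ.+-suc a d =
    trans (cong (λ x → sumℤ (a ℕ.+ d) f + x) (f≡0 (suc (a ℕ.+ d)) (s≤s (ℕₚ.m≤m+n a d))))
          (trans (ℤₚ.+-identityʳ _) (sumℤ-extend a d f f≡0))

  suc-∸ : ∀ {n i} → i ≤ n → suc n ∸ i ≡ suc (n ∸ i)
  suc-∸ i≤n = ℕₚ.+-∸-assoc 1 i≤n

  sumℤ-reverse : ∀ n (f : ℕ → ℤ) → sumℤ n f ≡ sumℤ n (λ i → f (n ∸ i))
  sumℤ-reverse zero    f = refl
  sumℤ-reverse (suc n) f = begin
    sumℤ n f + f (suc n)                          ≡⟨ cong (_+ f (suc n)) (sumℤ-reverse n f) ⟩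
    sumℤ n (λ i → f (n ∸ i)) + f (suc n)          ≡⟨ ℤₚ.+-comm _ (f (suc n)) ⟩
    f (suc n) + sumℤ n (λ i → f (n ∸ i))          ≡⟨ sumℤ-head n (λ i → f (suc n ∸ i)) ⟨
    sumℤ (suc n) (λ i → f (suc n ∸ i))            ∎
    where open ≡-Reasoning

  sumℤ-triangle : ∀ n (F : ℕ → ℕ → ℤ) →
    sumℤ n (λ k → sumℤ k (λ i → F i (k ∸ i))) ≡ sumℤ n (λ i → sumℤ (n ∸ i) (F i))
  sumℤ-triangle zero    F = refl
  sumℤ-triangle (suc n) F = begin
    sumℤ n diagonals + sumℤ (suc n) (λ i → F i (suc n ∸ i))
      ≡⟨ cong₂ _+_ (sumℤ-triangle n F) (cong (λ x → sumℤ n newDiagonal + F (suc n) x) (ℕₚ.n∸n≡0 n)) ⟩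
    rows n + (sumℤ n newDiagonal + F (suc n) 0)
      ≡⟨ ℤₚ.+-assoc (rows n) (sumℤ n newDiagonal) (F (suc n) 0) ⟨
    (rows n + sumℤ n newDiagonal) + F (suc n) 0
      ≡⟨ cong (_+ F (suc n) 0) (sumℤ-+ n (λ i → sumℤ (n ∸ i) (F i)) newDiagonal) ⟨
    sumℤ n (λ i → sumℤ (n ∸ i) (F i) + newDiagonal i) + F (suc n) 0
      ≡⟨ cong (_+ F (suc n) 0) (sumℤ-cong n extendRow) ⟩
    sumℤ n (λ i → sumℤ (suc n ∸ i) (F i)) + F (suc n) 0
      ≡⟨ cong (λ x → sumℤ n (λ i → sumℤ (suc n ∸ i) (F i)) + sumℤ x (F (suc n))) (ℕₚ.n∸n≡0 n) ⟨
    sumℤ n (λ i → sumℤ (suc n ∸ i) (F i)) + sumℤ (n ∸ n) (F (suc n))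
      ∎
    where
    open ≡-Reasoning
    diagonals : ℕ → ℤ
    diagonals k = sumℤ k (λ i → F i (k ∸ i))
    rows : ℕ → ℤ
    rows n = sumℤ n (λ i → sumℤ (n ∸ i) (F i))
    newDiagonal : ℕ → ℤ
    newDiagonal i = F i (suc n ∸ i)
    extendRow : ∀ i → i ≤ n → sumℤ (n ∸ i) (F i) + newDiagonal i ≡ sumℤ (suc n ∸ i) (F i)
    extendRow i i≤n rewrite suc-∸ {n} {i} i≤n = refl

  Series : Set
  Series = ℕ → ℤ

  infix 4 _≈_
  _≈_ : Series → Series → Set
  f ≈ g = ∀ n → f n ≡ g n

  ≈-refl : ∀ {f} → f ≈ f
  ≈-refl n = refl

  ≈-sym : ∀ {f g} → f ≈ g → g ≈ f
  ≈-sym f≈g n = sym (f≈g n)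

  ≈-trans : ∀ {f g h} → f ≈ g → g ≈ h → f ≈ h
  ≈-trans f≈g g≈h n = trans (f≈g n) (g≈h n)

  ≈-reflexive : ∀ {f g} → f ≡ g → f ≈ g
  ≈-reflexive refl = ≈-refl

  const : ℤ → Series
  const c zero    = c
  const c (suc n) = 0ℤ

  0S 1S : Series
  0S _ = 0ℤ
  1S = const 1ℤ

  infixl 6 _⊕_ _⊖_
  infixl 7 _⊛_
  infix  8 ⊝_

  _⊕_ : Series → Series → Series
  (f ⊕ g) n = f n + g n

  ⊝_ : Series → Series
  (⊝ f) n = - f n

  _⊖_ : Series → Series → Series
  f ⊖ g = f ⊕ ⊝ g

  -- The Cauchy product; kept opaque so that series expressions stay small.
  opaque
    _⊛_ : Series → Series → Series
    (f ⊛ g) n = sumℤ n (λ i → f i * g (n ∸ i))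

  opaque
    unfolding _⊛_

    ⊛-coeff : ∀ f g n → (f ⊛ g) n ≡ sumℤ n (λ i → f i * g (n ∸ i))
    ⊛-coeff f g n = refl

    ⊛-cong : ∀ {f f′ g g′} → f ≈ f′ → g ≈ g′ → f ⊛ g ≈ f′ ⊛ g′
    ⊛-cong f≈f′ g≈g′ n = sumℤ-cong n (λ i _ → cong₂ _*_ (f≈f′ i) (g≈g′ (n ∸ i)))

    ⊛-comm : ∀ f g → f ⊛ g ≈ g ⊛ f
    ⊛-comm f g n = trans (sumℤ-reverse n _) (sumℤ-cong n (λ i i≤n →
      trans (cong (λ x → f (n ∸ i) * g x) (ℕₚ.m∸[m∸n]≡n i≤n)) (ℤₚ.*-comm (f (n ∸ i)) (g i))))

    const-⊛ : ∀ c f → const c ⊛ f ≈ (λ n → c * f n)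
    const-⊛ c f zero    = refl
    const-⊛ c f (suc n) = trans (sumℤ-head n _)
      (trans (cong (λ x → c * f (suc n) + x) (sumℤ-zero n _ (λ i _ → ℤₚ.*-zeroˡ (f (n ∸ i)))))
             (ℤₚ.+-identityʳ _))

    ⊛-distribˡ : ∀ f g h → f ⊛ (g ⊕ h) ≈ f ⊛ g ⊕ f ⊛ h
    ⊛-distribˡ f g h n =
      trans (sumℤ-cong n (λ i _ → ℤₚ.*-distribˡ-+ (f i) (g (n ∸ i)) (h (n ∸ i)))) (sumℤ-+ n _ _)

    ⊛-assoc : ∀ f g h → (f ⊛ g) ⊛ h ≈ f ⊛ (g ⊛ h)
    ⊛-assoc f g h n = begin
      sumℤ n (λ k → sumℤ k (λ i → f i * g (k ∸ i)) * h (n ∸ k))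
        ≡⟨ sumℤ-cong n (λ k _ → sym (sumℤ-*ʳ k (h (n ∸ k)) _)) ⟩
      sumℤ n (λ k → sumℤ k (λ i → f i * g (k ∸ i) * h (n ∸ k)))
        ≡⟨ sumℤ-cong n (λ k _ → sumℤ-cong k (λ i i≤k →
             cong (λ x → f i * g (k ∸ i) * h (n ∸ x)) (sym (ℕₚ.m+[n∸m]≡n i≤k)))) ⟩
      sumℤ n (λ k → sumℤ k (λ i → F i (k ∸ i)))
        ≡⟨ sumℤ-triangle n F ⟩
      sumℤ n (λ i → sumℤ (n ∸ i) (F i))
        ≡⟨ sumℤ-cong n (λ i _ → trans (sumℤ-cong (n ∸ i) (λ j _ → reassociate i j))
                                      (sumℤ-*ˡ (n ∸ i) (f i) _)) ⟩
      sumℤ n (λ i → f i * sumℤ (n ∸ i) (λ j → g j * h (n ∸ i ∸ j)))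
        ∎
      where
      open ≡-Reasoning
      F : ℕ → ℕ → ℤ
      F i j = f i * g j * h (n ∸ (i ℕ.+ j))
      reassociate : ∀ i j → F i j ≡ f i * (g j * h (n ∸ i ∸ j))
      reassociate i j = trans (ℤₚ.*-assoc (f i) (g j) _)
                              (cong (λ x → f i * (g j * h x)) (sym (ℕₚ.∸-+-assoc n i j)))

  ⊛-identityˡ : ∀ f → 1S ⊛ f ≈ f
  ⊛-identityˡ f n = trans (const-⊛ 1ℤ f n) (ℤₚ.*-identityˡ (f n))

  ⊛-identityʳ : ∀ f → f ⊛ 1S ≈ f
  ⊛-identityʳ f = ≈-trans (⊛-comm f 1S) (⊛-identityˡ f)

  ⊛-distribʳ : ∀ h f g → (f ⊕ g) ⊛ h ≈ f ⊛ h ⊕ g ⊛ h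
  ⊛-distribʳ h f g n = trans (⊛-comm (f ⊕ g) h n)
    (trans (⊛-distribˡ h f g n) (cong₂ _+_ (⊛-comm h f n) (⊛-comm h g n)))

  seriesRing : CommutativeRing _ _
  seriesRing = record
    { Carrier = Series ; _≈_ = _≈_ ; _+_ = _⊕_ ; _*_ = _⊛_ ; -_ = ⊝_ ; 0# = 0S ; 1# = 1S
    ; isCommutativeRing = record
      { isRing = record
        { +-isAbelianGroup = record
          { isGroup = record
            { isMonoid = record
              { isSemigroup = record
                { isMagma = record
                  { isEquivalence = record { refl = ≈-refl ; sym = ≈-sym ; trans = ≈-trans }
                  ; ∙-cong = λ f≈f′ g≈g′ n → cong₂ _+_ (f≈f′ n) (g≈g′ n) }
                ; assoc = λ f g h n → ℤₚ.+-assoc (f n) (g n) (h n) }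
              ; identity = (λ f n → ℤₚ.+-identityˡ (f n)) , (λ f n → ℤₚ.+-identityʳ (f n)) }
            ; inverse = (λ f n → ℤₚ.+-inverseˡ (f n)) , (λ f n → ℤₚ.+-inverseʳ (f n))
            ; ⁻¹-cong = λ f≈f′ n → cong -_ (f≈f′ n) }
          ; comm = λ f g n → ℤₚ.+-comm (f n) (g n) }
        ; *-cong = ⊛-cong
        ; *-assoc = ⊛-assoc
        ; *-identity = ⊛-identityˡ , ⊛-identityʳ
        ; distrib = ⊛-distribˡ , ⊛-distribʳ }
      ; *-comm = ⊛-comm } }

  module ≈-Reasoning = Relation.Binary.Reasoning.Setoid (CommutativeRing.setoid seriesRing)

  -- Polynomial identities with integer coefficients hold in the ring of series:
  -- the ring solver, with ℤ embedded as constant series.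
  const-* : ∀ a b → const (a * b) ≈ const a ⊛ const b
  const-* a b zero    = sym (const-⊛ a (const b) 0)
  const-* a b (suc n) = trans (sym (ℤₚ.*-zeroʳ a)) (sym (const-⊛ a (const b) (suc n)))

  private
    constHom : ACR._-Raw-AlmostCommutative⟶_
                 (CommutativeRing.rawRing ℤₚ.+-*-commutativeRing) (ACR.fromCommutativeRing seriesRing)
    constHom = record
      { ⟦_⟧ = const
      ; +-homo = λ a b → λ { zero → refl ; (suc n) → refl }
      ; *-homo = const-*
      ; -‿homo = λ a → λ { zero → refl ; (suc n) → refl }
      ; 0-homo = λ { zero → refl ; (suc n) → refl }
      ; 1-homo = λ { zero → refl ; (suc n) → refl } }

    decideConst : ∀ (a b : ℤ) → Maybe (const a ≈ const b)
    decideConst a b with a ℤₚ.≟ b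
    ... | yes a≡b = just (λ n → cong (λ x → const x n) a≡b)
    ... | no _    = nothing

  open import Algebra.Solver.Ring (CommutativeRing.rawRing ℤₚ.+-*-commutativeRing)
    (ACR.fromCommutativeRing seriesRing) constHom decideConst
    using (solve; _:=_; _:+_; _:*_; _:-_; :-_) renaming (con to :const)

  ⊛-congˡ : ∀ {f f′} g → f ≈ f′ → f ⊛ g ≈ f′ ⊛ g
  ⊛-congˡ g f≈f′ = ⊛-cong f≈f′ (≈-refl {g})

  ⊛-congʳ : ∀ f {g g′} → g ≈ g′ → f ⊛ g ≈ f ⊛ g′
  ⊛-congʳ f g≈g′ = ⊛-cong (≈-refl {f}) g≈g′

  ⊕-cong : ∀ {f f′ g g′} → f ≈ f′ → g ≈ g′ → f ⊕ g ≈ f′ ⊕ g′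
  ⊕-cong f≈f′ g≈g′ n = cong₂ _+_ (f≈f′ n) (g≈g′ n)

  ⊝-cong : ∀ {f f′} → f ≈ f′ → ⊝ f ≈ ⊝ f′
  ⊝-cong f≈f′ n = cong -_ (f≈f′ n)

  ⊕-congʳ : ∀ f {g g′} → g ≈ g′ → f ⊕ g ≈ f ⊕ g′
  ⊕-congʳ f g≈g′ = ⊕-cong (≈-refl {f}) g≈g′

  ⊖-congʳ : ∀ f {g g′} → g ≈ g′ → f ⊖ g ≈ f ⊖ g′
  ⊖-congʳ f g≈g′ = ⊕-congʳ f (⊝-cong g≈g′)

  ⊕-identityˡ : ∀ f → 0S ⊕ f ≈ f
  ⊕-identityˡ f n = ℤₚ.+-identityˡ (f n)

  ⊛-zeroʳ : ∀ f → f ⊛ 0S ≈ 0S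
  ⊛-zeroʳ f n = trans (⊛-coeff f 0S n) (sumℤ-zero n _ (λ i _ → ℤₚ.*-zeroʳ (f i)))

  ⊛-zeroˡ : ∀ f → 0S ⊛ f ≈ 0S
  ⊛-zeroˡ f = ≈-trans (⊛-comm 0S f) (⊛-zeroʳ f)

  -- f ≈[ M ] g : f and g agree below degree M, i.e. f ≡ g (mod q^M).
  infix 4 _≈[_]_
  _≈[_]_ : Series → ℕ → Series → Set
  f ≈[ M ] g = ∀ m → m < M → f m ≡ g m

  ≈[]-refl : ∀ {f M} → f ≈[ M ] f
  ≈[]-refl m _ = refl

  ≈[]-sym : ∀ {f g M} → f ≈[ M ] g → g ≈[ M ] f
  ≈[]-sym f≈g m m<M = sym (f≈g m m<M)

  ≈[]-trans : ∀ {f g h M} → f ≈[ M ] g → g ≈[ M ] h → f ≈[ M ] h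
  ≈[]-trans f≈g g≈h m m<M = trans (f≈g m m<M) (g≈h m m<M)

  ≈⇒≈[] : ∀ {f g M} → f ≈ g → f ≈[ M ] g
  ≈⇒≈[] f≈g m _ = f≈g m

  ≈[]-setoid : ℕ → Setoid _ _
  ≈[]-setoid M = record
    { Carrier = Series ; _≈_ = _≈[ M ]_
    ; isEquivalence = record { refl = ≈[]-refl ; sym = ≈[]-sym ; trans = ≈[]-trans } }

  ⊕-cong-≈[] : ∀ {f f′ g g′ M} → f ≈[ M ] f′ → g ≈[ M ] g′ → f ⊕ g ≈[ M ] f′ ⊕ g′
  ⊕-cong-≈[] f≈f′ g≈g′ m m<M = cong₂ _+_ (f≈f′ m m<M) (g≈g′ m m<M)

  -- The m-th coefficient of a product only involves coefficients of degree ≤ m.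
  ⊛-cong-≈[] : ∀ {f f′ g g′ M} → f ≈[ M ] f′ → g ≈[ M ] g′ → f ⊛ g ≈[ M ] f′ ⊛ g′
  ⊛-cong-≈[] {f} {f′} {g} {g′} f≈f′ g≈g′ m m<M = begin
    (f ⊛ g) m                              ≡⟨ ⊛-coeff f g m ⟩
    sumℤ m (λ i → f i * g (m ∸ i))         ≡⟨ sumℤ-cong m (λ i i≤m →
        cong₂ _*_ (f≈f′ i (ℕₚ.≤-<-trans i≤m m<M)) (g≈g′ (m ∸ i) (ℕₚ.≤-<-trans (ℕₚ.m∸n≤m m i) m<M))) ⟩
    sumℤ m (λ i → f′ i * g′ (m ∸ i))       ≡⟨ ⊛-coeff f′ g′ m ⟨
    (f′ ⊛ g′) m                            ∎
    where open ≡-Reasoning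

  ⊛-lowest : ∀ f g m → (∀ i → i < m → f i ≡ 0ℤ) → (f ⊛ g) m ≡ f m * g 0
  ⊛-lowest f g zero    _   = ⊛-coeff f g 0
  ⊛-lowest f g (suc m) f≡0 = begin
    (f ⊛ g) (suc m)
      ≡⟨ ⊛-coeff f g (suc m) ⟩
    sumℤ m (λ i → f i * g (suc m ∸ i)) + f (suc m) * g (m ∸ m)
      ≡⟨ cong₂ _+_ lower (cong (λ x → f (suc m) * g x) (ℕₚ.n∸n≡0 m)) ⟩
    0ℤ + f (suc m) * g 0
      ≡⟨ ℤₚ.+-identityˡ _ ⟩
    f (suc m) * g 0
      ∎
    where
    open ≡-Reasoning
    lower : sumℤ m (λ i → f i * g (suc m ∸ i)) ≡ 0ℤ
    lower = sumℤ-zero m _ (λ i i≤m → trans (cong (_* g (suc m ∸ i)) (f≡0 i (s≤s i≤m))) (ℤₚ.*-zeroˡ (g (suc m ∸ i))))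

  ⊛-cancelʳ-≈[] : ∀ {f h g M} → g 0 ≡ 1ℤ → f ⊛ g ≈[ M ] h ⊛ g → f ≈[ M ] h
  ⊛-cancelʳ-≈[] {f} {h} {g} {M} g₀≡1 fg≈hg m m<M =
    ℤₚ.i-j≡0⇒i≡j (f m) (h m) (vanish (suc m) m<M m ℕₚ.≤-refl)
    where
    d : Series
    d = f ⊖ h
    dg≈0 : ∀ m → m < M → (d ⊛ g) m ≡ 0ℤ
    dg≈0 m m<M = begin
      (d ⊛ g) m                       ≡⟨ ⊛-distribʳ g f (⊝ h) m ⟩
      (f ⊛ g) m + ((⊝ h) ⊛ g) m       ≡⟨ cong (λ x → (f ⊛ g) m + x) (neg h g m) ⟩
      (f ⊛ g) m + - (h ⊛ g) m         ≡⟨ ℤₚ.i≡j⇒i-j≡0 (fg≈hg m m<M) ⟩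
      0ℤ                              ∎
      where
      open ≡-Reasoning
      neg : ∀ h g → (⊝ h) ⊛ g ≈ ⊝ (h ⊛ g)
      neg = solve 2 (λ h g → (:- h) :* g := :- (h :* g)) ≈-refl
    vanish : ∀ m → m ≤ M → ∀ i → i < m → d i ≡ 0ℤ
    vanish (suc m) m<M i i<1+m with ℕₚ.m≤n⇒m<n∨m≡n (ℕₚ.≤-pred i<1+m)
    ... | inj₁ i<m = vanish m (ℕₚ.<⇒≤ m<M) i i<m
    ... | inj₂ refl = begin
      d i               ≡⟨ ℤₚ.*-identityʳ (d i) ⟨
      d i * 1ℤ          ≡⟨ cong (d i *_) g₀≡1 ⟨
      d i * g 0         ≡⟨ ⊛-lowest d g i (vanish i (ℕₚ.<⇒≤ m<M)) ⟨
      (d ⊛ g) i         ≡⟨ dg≈0 i m<M ⟩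
      0ℤ                ∎
      where open ≡-Reasoning

  q^_ : ℕ → Series
  q^ zero = 1S
  (q^ suc a) zero    = 0ℤ
  (q^ suc a) (suc n) = (q^ a) n

  q^-zero : ∀ a n → n < a → (q^ a) n ≡ 0ℤ
  q^-zero (suc a) zero    _         = refl
  q^-zero (suc a) (suc n) (s≤s n<a) = q^-zero a n n<a

  q^-⊛-low : ∀ a f n → n < a → (q^ a ⊛ f) n ≡ 0ℤ
  q^-⊛-low a f n n<a = trans (⊛-lowest (q^ a) f n (λ i i<n → q^-zero a i (ℕₚ.<-trans i<n n<a)))
                             (trans (cong (_* f 0) (q^-zero a n n<a)) (ℤₚ.*-zeroˡ (f 0)))

  q^-⊛-high : ∀ a f n → (q^ a ⊛ f) (a ℕ.+ n) ≡ f n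
  q^-⊛-high zero    f n = ⊛-identityˡ f n
  q^-⊛-high (suc a) f n = begin
    (q^ suc a ⊛ f) (suc a ℕ.+ n)                     ≡⟨ ⊛-coeff (q^ suc a) f (suc (a ℕ.+ n)) ⟩
    sumℤ (suc (a ℕ.+ n)) (λ i → (q^ suc a) i * f (suc (a ℕ.+ n) ∸ i))
                                                     ≡⟨ sumℤ-head (a ℕ.+ n) _ ⟩
    0ℤ * f (suc (a ℕ.+ n)) + sumℤ (a ℕ.+ n) (λ i → (q^ a) i * f (a ℕ.+ n ∸ i))
                                                     ≡⟨ cong₂ _+_ (ℤₚ.*-zeroˡ (f (suc (a ℕ.+ n)))) (⊛-coeff (q^ a) f (a ℕ.+ n)) ⟨
    0ℤ + (q^ a ⊛ f) (a ℕ.+ n)                        ≡⟨ ℤₚ.+-identityˡ _ ⟩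
    (q^ a ⊛ f) (a ℕ.+ n)                             ≡⟨ q^-⊛-high a f n ⟩
    f n                                              ∎
    where open ≡-Reasoning

  q^-≡ : ∀ {a b} → a ≡ b → q^ a ≈ q^ b
  q^-≡ a≡b = ≈-reflexive (cong q^_ a≡b)

  q^-+ : ∀ a b → q^ (a ℕ.+ b) ≈ q^ a ⊛ q^ b
  q^-+ a b n with ℕₚ.<-≤-connex n a
  ... | inj₁ n<a = trans (q^-zero (a ℕ.+ b) n (ℕₚ.<-≤-trans n<a (ℕₚ.m≤m+n a b))) (sym (q^-⊛-low a (q^ b) n n<a))
  ... | inj₂ a≤n with ℕₚ.m≤n⇒∃[o]m+o≡n a≤n
  ...   | k , refl = trans (same a) (sym (q^-⊛-high a (q^ b) k))
    where
    same : ∀ a → (q^ (a ℕ.+ b)) (a ℕ.+ k) ≡ (q^ b) k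
    same zero    = refl
    same (suc a) = same a

  q^-cancel : ∀ a {f g} → q^ a ⊛ f ≈ q^ a ⊛ g → f ≈ g
  q^-cancel a {f} {g} af≈ag n = trans (sym (q^-⊛-high a f n)) (trans (af≈ag (a ℕ.+ n)) (q^-⊛-high a g n))

  q^-⊛-≈[] : ∀ {a M} f → M ≤ a → q^ a ⊛ f ≈[ M ] 0S
  q^-⊛-≈[] {a} f M≤a m m<M = q^-⊛-low a f m (ℕₚ.<-≤-trans m<M M≤a)

  sgn : ℕ → ℤ
  sgn zero    = 1ℤ
  sgn (suc k) = - sgn k

  sgn-+ : ∀ a b → sgn (a ℕ.+ b) ≡ sgn a * sgn b
  sgn-+ zero    b = sym (ℤₚ.*-identityˡ (sgn b))
  sgn-+ (suc a) b = trans (cong -_ (sgn-+ a b)) (ℤₚ.neg-distribˡ-* (sgn a) (sgn b))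

  sgn-square : ∀ a → sgn a * sgn a ≡ 1ℤ
  sgn-square zero    = refl
  sgn-square (suc a) = trans (negSquare (sgn a)) (sgn-square a)
    where
    negSquare : ∀ x → - x * - x ≡ x * x
    negSquare = solve-∀

  ∑ : ℕ → (ℕ → Series) → Series
  ∑ k F n = sumℤ k (λ j → F j n)

  ∏ : ℕ → (ℕ → Series) → Series
  ∏ zero    F = 1S
  ∏ (suc k) F = ∏ k F ⊛ F k

  ∑-cong : ∀ k {F G} → (∀ j → j ≤ k → F j ≈ G j) → ∑ k F ≈ ∑ k G
  ∑-cong k F≈G n = sumℤ-cong k (λ j j≤k → F≈G j j≤k n)

  ∑-cong-≈[] : ∀ k {F G M} → (∀ j → j ≤ k → F j ≈[ M ] G j) → ∑ k F ≈[ M ] ∑ k G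
  ∑-cong-≈[] k F≈G n n<M = sumℤ-cong k (λ j j≤k → F≈G j j≤k n n<M)

  ∑-head : ∀ k F → ∑ (suc k) F ≈ F 0 ⊕ ∑ k (λ j → F (suc j))
  ∑-head k F n = sumℤ-head k (λ j → F j n)

  ∑-⊕ : ∀ k F G → ∑ k (λ j → F j ⊕ G j) ≈ ∑ k F ⊕ ∑ k G
  ∑-⊕ k F G n = sumℤ-+ k (λ j → F j n) (λ j → G j n)

  ∑-⊝ : ∀ k F → ∑ k (λ j → ⊝ F j) ≈ ⊝ ∑ k F
  ∑-⊝ k F n = sumℤ-neg k (λ j → F j n)

  ∑-⊛ : ∀ k F g → ∑ k F ⊛ g ≈ ∑ k (λ j → F j ⊛ g)
  ∑-⊛ zero    F g = ≈-refl
  ∑-⊛ (suc k) F g = ≈-trans (⊛-distribʳ g (∑ k F) (F (suc k))) (⊕-cong (∑-⊛ k F g) ≈-refl)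

  ⊛-∑ : ∀ k F g → g ⊛ ∑ k F ≈ ∑ k (λ j → g ⊛ F j)
  ⊛-∑ k F g = ≈-trans (⊛-comm g (∑ k F)) (≈-trans (∑-⊛ k F g) (∑-cong k (λ j _ → ⊛-comm (F j) g)))

  ∏-cong : ∀ N {F G} → (∀ i → i < N → F i ≈ G i) → ∏ N F ≈ ∏ N G
  ∏-cong zero    F≈G = ≈-refl
  ∏-cong (suc N) F≈G = ⊛-cong (∏-cong N (λ i i<N → F≈G i (ℕₚ.m<n⇒m<1+n i<N))) (F≈G N ℕₚ.≤-refl)

  ∏-head : ∀ N F → ∏ (suc N) F ≈ F 0 ⊛ ∏ N (λ i → F (suc i))
  ∏-head zero    F = ⊛-comm 1S (F 0)
  ∏-head (suc N) F = ≈-trans (⊛-congˡ (F (suc N)) (∏-head N F)) (⊛-assoc (F 0) _ (F (suc N)))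

  ∏-⊛ : ∀ N F G → ∏ N (λ i → F i ⊛ G i) ≈ ∏ N F ⊛ ∏ N G
  ∏-⊛ zero    F G = ≈-sym (⊛-identityˡ 1S)
  ∏-⊛ (suc N) F G = ≈-trans (⊛-congˡ (F N ⊛ G N) (∏-⊛ N F G)) (interchange (∏ N F) (F N) (∏ N G) (G N))
    where
    interchange : ∀ a b c d → (a ⊛ c) ⊛ (b ⊛ d) ≈ (a ⊛ b) ⊛ (c ⊛ d)
    interchange = solve 4 (λ a b c d → (a :* c) :* (b :* d) := (a :* b) :* (c :* d)) ≈-refl

  1-q^ : ℕ → Series
  1-q^ a = 1S ⊖ q^ a

  1-q^-const : ∀ a → 0 < a → (1-q^ a) 0 ≡ 1ℤ
  1-q^-const (suc a) _ = refl

  1-q^-≈[] : ∀ {M} a → M ≤ a → 1-q^ a ≈[ M ] 1S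
  1-q^-≈[] {M} a M≤a m m<M = trans (cong (λ t → 1S m + - t) (q^-zero a m (ℕₚ.<-≤-trans m<M M≤a)))
                                   (ℤₚ.+-identityʳ (1S m))

  poch : (ℕ → ℕ) → ℕ → Series
  poch e N = ∏ N (λ i → 1-q^ (e i))

  poch-const : ∀ e N → (∀ i → i < e i) → poch e N 0 ≡ 1ℤ
  poch-const e zero    _   = refl
  poch-const e (suc N) i<e = trans (⊛-lowest (poch e N) (1-q^ (e N)) 0 (λ _ ()))
    (cong₂ _*_ (poch-const e N i<e) (1-q^-const (e N) (ℕₚ.≤-<-trans z≤n (i<e N))))

  poch-≈[] : ∀ e {M N} → (∀ i → i < e i) → M ≤ N → poch e N ≈[ M ] poch e M
  poch-≈[] e {M} i<e M≤N with ℕₚ.m≤n⇒∃[o]m+o≡n M≤N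
  ... | d , refl = extra d
    where
    extra : ∀ d → poch e (M ℕ.+ d) ≈[ M ] poch e M
    extra zero    = subst (λ N → poch e N ≈[ M ] poch e M) (sym (ℕₚ.+-identityʳ M)) ≈[]-refl
    extra (suc d) rewrite ℕₚ.+-suc M d =
      ≈[]-trans (⊛-cong-≈[] (extra d) (1-q^-≈[] (e (M ℕ.+ d)) (ℕₚ.≤-trans (ℕₚ.m≤m+n M d) (ℕₚ.<⇒≤ (i<e (M ℕ.+ d))))))
                (≈⇒≈[] (⊛-identityʳ (poch e M)))

  double : ℕ → ℕ
  double zero    = zero
  double (suc n) = suc (suc (double n))

  double≡ : ∀ n → double n ≡ n ℕ.+ n
  double≡ zero    = refl
  double≡ (suc n) = cong suc (trans (cong suc (double≡ n)) (sym (ℕₚ.+-suc n n)))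

  double-+ : ∀ a b → double (a ℕ.+ b) ≡ double a ℕ.+ double b
  double-+ zero    b = refl
  double-+ (suc a) b = cong (λ x → suc (suc x)) (double-+ a b)

  qPoch : ℕ → Series
  qPoch = poch suc

  qPoch⁺ : ℕ → Series
  qPoch⁺ K = ∏ K (λ i → 1S ⊕ q^ suc i)

  oddPoch : ℕ → Series
  oddPoch = poch (λ i → suc (double i))

  evenPoch : ℕ → Series
  evenPoch = poch (λ i → double (suc i))

  qPoch-⊛-qPoch⁺ : ∀ K → qPoch K ⊛ qPoch⁺ K ≈ evenPoch K
  qPoch-⊛-qPoch⁺ zero    = ⊛-identityˡ 1S
  qPoch-⊛-qPoch⁺ (suc K) = ≈-trans (interchange (qPoch K) (qPoch⁺ K) (1-q^ (suc K)) (1S ⊕ q^ suc K))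
    (⊛-cong (qPoch-⊛-qPoch⁺ K)
            (≈-trans (difference-of-squares (q^ suc K))
                     (⊖-congʳ 1S (≈-trans (≈-sym (q^-+ (suc K) (suc K))) (q^-≡ (sym (double≡ (suc K))))))))
    where
    interchange : ∀ a b c d → (a ⊛ c) ⊛ (b ⊛ d) ≈ (a ⊛ b) ⊛ (c ⊛ d)
    interchange = solve 4 (λ a b c d → (a :* c) :* (b :* d) := (a :* b) :* (c :* d)) ≈-refl
    difference-of-squares : ∀ x → (1S ⊖ x) ⊛ (1S ⊕ x) ≈ 1S ⊖ x ⊛ x
    difference-of-squares = solve 1 (λ x → (:const 1ℤ :- x) :* (:const 1ℤ :+ x) := :const 1ℤ :- x :* x) ≈-refl

  -- (q;q)_{2n} = (q;q²)_n (q²;q²)_n: split the factors by the parity of the exponent.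
  qPoch-double : ∀ n → qPoch (double n) ≈ oddPoch n ⊛ evenPoch n
  qPoch-double zero    = ≈-sym (⊛-identityˡ 1S)
  qPoch-double (suc n) = ≈-trans (⊛-congˡ (1-q^ (double (suc n))) (⊛-congˡ (1-q^ (suc (double n))) (qPoch-double n)))
    (regroup (oddPoch n) (evenPoch n) (1-q^ (suc (double n))) (1-q^ (double (suc n))))
    where
    regroup : ∀ a b c d → ((a ⊛ b) ⊛ c) ⊛ d ≈ (a ⊛ c) ⊛ (b ⊛ d)
    regroup = solve 4 (λ a b c d → ((a :* b) :* c) :* d := (a :* c) :* (b :* d)) ≈-refl

  -- The Gaussian binomial coefficient [N, j] in base q², defined by the q-Pascal recurrence
  -- [N+1, j+1] = [N, j+1] + q^{2(N-j)} [N, j].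
  binom₂ : ℕ → ℕ → Series
  binom₂ N       zero    = 1S
  binom₂ zero    (suc j) = 0S
  binom₂ (suc N) (suc j) = binom₂ N (suc j) ⊕ q^ double (N ∸ j) ⊛ binom₂ N j

  binom₂-vanish : ∀ N j → N < j → binom₂ N j ≈ 0S
  binom₂-vanish zero    (suc j) _         = ≈-refl
  binom₂-vanish (suc N) (suc j) (s≤s N<j) n = begin
    binom₂ N (suc j) n + (q^ double (N ∸ j) ⊛ binom₂ N j) n
      ≡⟨ cong₂ _+_ (binom₂-vanish N (suc j) (ℕₚ.m<n⇒m<1+n N<j) n)
                   (trans (⊛-congʳ (q^ double (N ∸ j)) (binom₂-vanish N j N<j) n) (⊛-zeroʳ _ n)) ⟩
    0ℤ                                                       ∎
    where open ≡-Reasoning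

  binom₂-evenPoch : ∀ N j → j ≤ N → binom₂ N j ⊛ evenPoch j ⊛ evenPoch (N ∸ j) ≈ evenPoch N
  binom₂-evenPoch N       zero    _ = ≈-trans (⊛-congˡ (evenPoch N) (⊛-identityˡ 1S)) (⊛-identityˡ (evenPoch N))
  binom₂-evenPoch (suc N) (suc j) (s≤s j≤N) with ℕₚ.m≤n⇒m<n∨m≡n j≤N
  ... | inj₁ j<N = begin
    binom₂ (suc N) (suc j) ⊛ evenPoch (suc j) ⊛ evenPoch (N ∸ j)
      ≈⟨ ⊛-congʳ _ (≈-reflexive (cong evenPoch (suc-∸ j<N))) ⟩
    (binom₂ N (suc j) ⊕ q^ double (N ∸ j) ⊛ binom₂ N j) ⊛ evenPoch (suc j) ⊛ (evenPoch d ⊛ (1S ⊖ x))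
      ≈⟨ ⊛-congˡ _ (⊛-congˡ _ (⊕-congʳ (binom₂ N (suc j)) (⊛-congˡ (binom₂ N j) (q^-≡ (cong double (suc-∸ j<N)))))) ⟩
    (binom₂ N (suc j) ⊕ x ⊛ binom₂ N j) ⊛ (evenPoch j ⊛ (1S ⊖ y)) ⊛ (evenPoch d ⊛ (1S ⊖ x))
      ≈⟨ expand (binom₂ N (suc j)) (binom₂ N j) (evenPoch j) (evenPoch d) x y ⟩
    binom₂ N (suc j) ⊛ evenPoch (suc j) ⊛ evenPoch d ⊛ (1S ⊖ x)
      ⊕ (x ⊛ (1S ⊖ y)) ⊛ (binom₂ N j ⊛ evenPoch j ⊛ (evenPoch d ⊛ (1S ⊖ x)))
      ≈⟨ ⊕-cong (⊛-congˡ (1S ⊖ x) (binom₂-evenPoch N (suc j) j<N))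
                (⊛-congʳ (x ⊛ (1S ⊖ y)) (≈-trans (⊛-congʳ _ (≈-reflexive (cong evenPoch (sym (suc-∸ j<N))))) (binom₂-evenPoch N j j≤N))) ⟩
    evenPoch N ⊛ (1S ⊖ x) ⊕ (x ⊛ (1S ⊖ y)) ⊛ evenPoch N
      ≈⟨ collect (evenPoch N) x y ⟩
    evenPoch N ⊛ (1S ⊖ x ⊛ y)
      ≈⟨ ⊛-congʳ (evenPoch N) (⊖-congʳ 1S (≈-trans (≈-sym (q^-+ (double (suc d)) (double (suc j)))) (q^-≡ exponent))) ⟩
    evenPoch (suc N)
      ∎
    where
    open ≈-Reasoning
    d : ℕ
    d = N ∸ suc j
    x y : Series
    x = q^ double (suc d)
    y = q^ double (suc j)
    exponent : double (suc d) ℕ.+ double (suc j) ≡ double (suc N)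
    exponent = trans (sym (double-+ (suc d) (suc j))) (cong double (trans (ℕₚ.+-suc (suc d) j)
                 (cong suc (trans (ℕₚ.+-comm (suc d) j) (trans (cong (j ℕ.+_) (sym (suc-∸ j<N))) (ℕₚ.m+[n∸m]≡n j≤N))))))
    expand : ∀ b₁ b₀ Eⱼ E_d x y →
      (b₁ ⊕ x ⊛ b₀) ⊛ (Eⱼ ⊛ (1S ⊖ y)) ⊛ (E_d ⊛ (1S ⊖ x)) ≈
      b₁ ⊛ (Eⱼ ⊛ (1S ⊖ y)) ⊛ E_d ⊛ (1S ⊖ x) ⊕ (x ⊛ (1S ⊖ y)) ⊛ (b₀ ⊛ Eⱼ ⊛ (E_d ⊛ (1S ⊖ x)))
    expand = solve 6 (λ b₁ b₀ Eⱼ E_d x y →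
      (b₁ :+ x :* b₀) :* (Eⱼ :* (:const 1ℤ :- y)) :* (E_d :* (:const 1ℤ :- x)) :=
      b₁ :* (Eⱼ :* (:const 1ℤ :- y)) :* E_d :* (:const 1ℤ :- x) :+ (x :* (:const 1ℤ :- y)) :* (b₀ :* Eⱼ :* (E_d :* (:const 1ℤ :- x))))
      ≈-refl
    collect : ∀ E x y → E ⊛ (1S ⊖ x) ⊕ (x ⊛ (1S ⊖ y)) ⊛ E ≈ E ⊛ (1S ⊖ x ⊛ y)
    collect = solve 3 (λ E x y → E :* (:const 1ℤ :- x) :+ (x :* (:const 1ℤ :- y)) :* E :=
      E :* (:const 1ℤ :- x :* y)) ≈-refl
  ... | inj₂ refl = begin
    (binom₂ j (suc j) ⊕ q^ double (j ∸ j) ⊛ binom₂ j j) ⊛ (evenPoch j ⊛ (1S ⊖ y)) ⊛ evenPoch (j ∸ j)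
      ≈⟨ ⊛-cong (⊛-congˡ _ (⊕-cong (binom₂-vanish j (suc j) ℕₚ.≤-refl) (⊛-congˡ _ (q^-≡ (cong double j∸j≡0)))))
                (≈-reflexive (cong evenPoch j∸j≡0)) ⟩
    (0S ⊕ 1S ⊛ binom₂ j j) ⊛ (evenPoch j ⊛ (1S ⊖ y)) ⊛ 1S
      ≈⟨ ⊛-congˡ 1S (⊛-congˡ _ (⊕-identityˡ (1S ⊛ binom₂ j j))) ⟩
    1S ⊛ binom₂ j j ⊛ (evenPoch j ⊛ (1S ⊖ y)) ⊛ 1S
      ≈⟨ regroup (binom₂ j j) (evenPoch j) y ⟩
    binom₂ j j ⊛ evenPoch j ⊛ 1S ⊛ (1S ⊖ y)
      ≈⟨ ⊛-congˡ (1S ⊖ y) (⊛-congʳ _ (≈-reflexive (cong evenPoch (sym j∸j≡0)))) ⟩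
    binom₂ j j ⊛ evenPoch j ⊛ evenPoch (j ∸ j) ⊛ (1S ⊖ y)
      ≈⟨ ⊛-congˡ (1S ⊖ y) (binom₂-evenPoch j j ℕₚ.≤-refl) ⟩
    evenPoch (suc j)
      ∎
    where
    open ≈-Reasoning
    j∸j≡0 : j ∸ j ≡ 0
    j∸j≡0 = ℕₚ.n∸n≡0 j
    y : Series
    y = q^ double (suc j)
    regroup : ∀ b E y → 1S ⊛ b ⊛ (E ⊛ (1S ⊖ y)) ⊛ 1S ≈ b ⊛ E ⊛ 1S ⊛ (1S ⊖ y)
    regroup = solve 3 (λ b E y → :const 1ℤ :* b :* (E :* (:const 1ℤ :- y)) :* :const 1ℤ :=
                                 b :* E :* :const 1ℤ :* (:const 1ℤ :- y)) ≈-refl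

  infixl 8 _⊛^_
  _⊛^_ : Series → ℕ → Series
  z ⊛^ zero  = 1S
  z ⊛^ suc k = z ⊛^ k ⊛ z

  const-neg : ∀ a → const (- a) ≈ ⊝ const a
  const-neg a zero    = refl
  const-neg a (suc n) = refl

  tri₂ : ℕ → ℕ
  tri₂ j = j ℕ.* (j ∸ 1)

  tri₂-step : ∀ j t → tri₂ (suc j) ℕ.+ double t ≡ tri₂ j ℕ.+ double (j ℕ.+ t)
  tri₂-step zero    t = refl
  tri₂-step (suc k) t rewrite double≡ t | double≡ (suc k ℕ.+ t) = arithmetic k t
    where
    arithmetic : ∀ k t → suc (suc k) ℕ.* suc k ℕ.+ (t ℕ.+ t) ≡ suc k ℕ.* k ℕ.+ ((suc k ℕ.+ t) ℕ.+ (suc k ℕ.+ t))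
    arithmetic = ℕ-solve-∀

  rotheProd : Series → ℕ → Series
  rotheProd z N = ∏ N (λ i → z ⊖ q^ double i)

  -- Rothe's q-binomial theorem in base q²:
  --   ∏_{i<N} (z - q^{2i}) = Σ_{j≤N} (-1)^j q^{j(j-1)} [N, j] z^{N-j}.
  rotheTerm : Series → ℕ → ℕ → Series
  rotheTerm z N j = const (sgn j) ⊛ (q^ tri₂ j ⊛ (binom₂ N j ⊛ z ⊛^ (N ∸ j)))

  rothe : ∀ z N → rotheProd z N ≈ ∑ N (rotheTerm z N)
  rothe z zero    = ≈-sym (≈-trans (⊛-identityˡ _) (≈-trans (⊛-identityˡ _) (⊛-identityˡ 1S)))
  rothe z (suc N) = ≈-trans expandProduct (≈-sym expandSum)
    where
    open ≈-Reasoning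
    -- the two families of terms that both sides are rearranged into
    U V : ℕ → Series
    U j = const (sgn j) ⊛ (q^ tri₂ j ⊛ (binom₂ N j ⊛ z ⊛^ (suc N ∸ j)))
    V j = const (sgn j) ⊛ (q^ (tri₂ j ℕ.+ double N) ⊛ (binom₂ N j ⊛ z ⊛^ (N ∸ j)))
    multiply : ∀ j → j ≤ N → rotheTerm z N j ⊛ (z ⊖ q^ double N) ≈ U j ⊖ V j
    multiply j j≤N = begin
      const (sgn j) ⊛ (q^ tri₂ j ⊛ (binom₂ N j ⊛ z ⊛^ (N ∸ j))) ⊛ (z ⊖ q^ double N)
        ≈⟨ distribute (const (sgn j)) (q^ tri₂ j) (binom₂ N j) (z ⊛^ (N ∸ j)) z (q^ double N) ⟩
      const (sgn j) ⊛ (q^ tri₂ j ⊛ (binom₂ N j ⊛ (z ⊛^ (N ∸ j) ⊛ z)))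
        ⊖ const (sgn j) ⊛ ((q^ tri₂ j ⊛ q^ double N) ⊛ (binom₂ N j ⊛ z ⊛^ (N ∸ j)))
        ≈⟨ ⊕-cong (⊛-congʳ _ (⊛-congʳ _ (⊛-congʳ _ (≈-reflexive (cong (z ⊛^_) (sym (suc-∸ j≤N)))))))
                  (⊝-cong (⊛-congʳ _ (⊛-congˡ _ (≈-sym (q^-+ (tri₂ j) (double N)))))) ⟩
      U j ⊖ V j
        ∎
      where
      distribute : ∀ s Q B Z z x → s ⊛ (Q ⊛ (B ⊛ Z)) ⊛ (z ⊖ x) ≈ s ⊛ (Q ⊛ (B ⊛ (Z ⊛ z))) ⊖ s ⊛ ((Q ⊛ x) ⊛ (B ⊛ Z))
      distribute = solve 6 (λ s Q B Z z x →
        s :* (Q :* (B :* Z)) :* (z :- x) := s :* (Q :* (B :* (Z :* z))) :- s :* ((Q :* x) :* (B :* Z))) ≈-refl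
    -- expanding the terms for N + 1 by the q-Pascal recurrence
    pascal : ∀ j → j ≤ N → rotheTerm z (suc N) (suc j) ≈ U (suc j) ⊖ V j
    pascal j j≤N = begin
      const (- sgn j) ⊛ (q^ tri₂ (suc j) ⊛ ((binom₂ N (suc j) ⊕ q^ double (N ∸ j) ⊛ binom₂ N j) ⊛ z ⊛^ (N ∸ j)))
        ≈⟨ ⊛-congˡ _ (const-neg (sgn j)) ⟩
      ⊝ const (sgn j) ⊛ (q^ tri₂ (suc j) ⊛ ((binom₂ N (suc j) ⊕ q^ double (N ∸ j) ⊛ binom₂ N j) ⊛ z ⊛^ (N ∸ j)))
        ≈⟨ distribute (const (sgn j)) (q^ tri₂ (suc j)) (binom₂ N (suc j)) (q^ double (N ∸ j)) (binom₂ N j) (z ⊛^ (N ∸ j)) ⟩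
      ⊝ const (sgn j) ⊛ (q^ tri₂ (suc j) ⊛ (binom₂ N (suc j) ⊛ z ⊛^ (N ∸ j)))
        ⊖ const (sgn j) ⊛ ((q^ tri₂ (suc j) ⊛ q^ double (N ∸ j)) ⊛ (binom₂ N j ⊛ z ⊛^ (N ∸ j)))
        ≈⟨ ⊕-cong (⊛-congˡ _ (≈-sym (const-neg (sgn j))))
                  (⊝-cong (⊛-congʳ _ (⊛-congˡ _ (≈-trans (≈-sym (q^-+ (tri₂ (suc j)) (double (N ∸ j)))) (q^-≡ exponent))))) ⟩
      U (suc j) ⊖ V j
        ∎
      where
      exponent : tri₂ (suc j) ℕ.+ double (N ∸ j) ≡ tri₂ j ℕ.+ double N
      exponent = trans (tri₂-step j (N ∸ j)) (cong (λ t → tri₂ j ℕ.+ double t) (ℕₚ.m+[n∸m]≡n j≤N))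
      distribute : ∀ s Q B₁ D B₀ Z → ⊝ s ⊛ (Q ⊛ ((B₁ ⊕ D ⊛ B₀) ⊛ Z)) ≈ ⊝ s ⊛ (Q ⊛ (B₁ ⊛ Z)) ⊖ s ⊛ ((Q ⊛ D) ⊛ (B₀ ⊛ Z))
      distribute = solve 6 (λ s Q B₁ D B₀ Z →
        :- s :* (Q :* ((B₁ :+ D :* B₀) :* Z)) := :- s :* (Q :* (B₁ :* Z)) :- s :* ((Q :* D) :* (B₀ :* Z))) ≈-refl
    U-top : U (suc N) ≈ 0S
    U-top = ≈-trans (⊛-congʳ _ (≈-trans (⊛-congʳ _ (≈-trans (⊛-congˡ _ (binom₂-vanish N (suc N) ℕₚ.≤-refl))
                                                             (⊛-zeroˡ _)))
                                       (⊛-zeroʳ _)))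
                    (⊛-zeroʳ _)
    expandProduct : rotheProd z (suc N) ≈ ∑ N U ⊖ ∑ N V
    expandProduct = begin
      rotheProd z N ⊛ (z ⊖ q^ double N)
        ≈⟨ ⊛-congˡ _ (rothe z N) ⟩
      ∑ N (rotheTerm z N) ⊛ (z ⊖ q^ double N)
        ≈⟨ ∑-⊛ N (rotheTerm z N) _ ⟩
      ∑ N (λ j → rotheTerm z N j ⊛ (z ⊖ q^ double N))
        ≈⟨ ∑-cong N multiply ⟩
      ∑ N (λ j → U j ⊖ V j)
        ≈⟨ ∑-⊕ N U (λ j → ⊝ V j) ⟩
      ∑ N U ⊕ ∑ N (λ j → ⊝ V j)
        ≈⟨ ⊕-congʳ (∑ N U) (∑-⊝ N V) ⟩
      ∑ N U ⊖ ∑ N V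
        ∎
    expandSum : ∑ (suc N) (rotheTerm z (suc N)) ≈ ∑ N U ⊖ ∑ N V
    expandSum = begin
      ∑ (suc N) (rotheTerm z (suc N))
        ≈⟨ ∑-head N (rotheTerm z (suc N)) ⟩
      U 0 ⊕ ∑ N (λ j → rotheTerm z (suc N) (suc j))
        ≈⟨ ⊕-congʳ (U 0) (≈-trans (∑-cong N pascal) (∑-⊕ N (λ j → U (suc j)) (λ j → ⊝ V j))) ⟩
      U 0 ⊕ (∑ N (λ j → U (suc j)) ⊕ ∑ N (λ j → ⊝ V j))
        ≈⟨ ⊕-congʳ (U 0) (⊕-congʳ (∑ N (λ j → U (suc j))) (∑-⊝ N V)) ⟩
      U 0 ⊕ (∑ N (λ j → U (suc j)) ⊖ ∑ N V)
        ≈⟨ reassociate (U 0) (∑ N (λ j → U (suc j))) (∑ N V) ⟩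
      (U 0 ⊕ ∑ N (λ j → U (suc j))) ⊖ ∑ N V
        ≈⟨ ⊕-cong (≈-sym (∑-head N U)) ≈-refl ⟩
      ∑ N U ⊕ U (suc N) ⊖ ∑ N V
        ≈⟨ ⊕-cong (⊕-congʳ (∑ N U) U-top) ≈-refl ⟩
      ∑ N U ⊕ 0S ⊖ ∑ N V
        ≈⟨ ⊕-cong (λ n → ℤₚ.+-identityʳ (∑ N U n)) ≈-refl ⟩
      ∑ N U ⊖ ∑ N V
        ∎
      where
      reassociate : ∀ a b c → a ⊕ (b ⊖ c) ≈ (a ⊕ b) ⊖ c
      reassociate = solve 3 (λ a b c → a :+ (b :- c) := (a :+ b) :- c) ≈-refl

  rotheProd-cong : ∀ {z z′} N → z ≈ z′ → rotheProd z N ≈ rotheProd z′ N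
  rotheProd-cong N z≈z′ = ∏-cong N (λ i _ → ⊕-cong z≈z′ ≈-refl)

  rotheProd-shift : ∀ z N → rotheProd (q^ 2 ⊛ z) (suc N) ≈ (q^ 2 ⊛ z ⊖ 1S) ⊛ (q^ double N ⊛ rotheProd z N)
  rotheProd-shift z N = ≈-trans (∏-head N (λ i → q^ 2 ⊛ z ⊖ q^ double i))
    (⊛-congʳ (q^ 2 ⊛ z ⊖ 1S) (≈-trans (∏-cong N (λ i _ → factor i))
      (≈-trans (∏-⊛ N (λ _ → q^ 2) (λ i → z ⊖ q^ double i)) (⊛-congˡ (rotheProd z N) (q²-power N)))))
    where
    factor : ∀ i → q^ 2 ⊛ z ⊖ q^ double (suc i) ≈ q^ 2 ⊛ (z ⊖ q^ double i)
    factor i = ≈-trans (⊖-congʳ (q^ 2 ⊛ z) (q^-+ 2 (double i)))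
      (solve 3 (λ a z d → a :* z :- a :* d := a :* (z :- d)) ≈-refl (q^ 2) z (q^ double i))
    q²-power : ∀ N → ∏ N (λ _ → q^ 2) ≈ q^ double N
    q²-power zero    = ≈-refl
    q²-power (suc N) = ≈-trans (⊛-congˡ (q^ 2) (q²-power N))
      (≈-trans (≈-sym (q^-+ (double N) 2)) (q^-≡ (ℕₚ.+-comm (double N) 2)))

  oddExp : ℕ → ℕ
  oddExp m = suc m ℕ.* suc (3 ℕ.* m)

  double-double : ∀ m → double (double (suc m)) ≡ suc (double m) ℕ.+ suc (suc (suc (double m)))
  double-double m rewrite double≡ m | double≡ (m ℕ.+ m) = arithmetic m
    where
    arithmetic : ∀ m → suc (suc (suc (suc ((m ℕ.+ m) ℕ.+ (m ℕ.+ m))))) ≡ suc (m ℕ.+ m) ℕ.+ suc (suc (suc (m ℕ.+ m)))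
    arithmetic = ℕ-solve-∀

  oddExp-step : ∀ m → double (suc (double (suc m))) ℕ.+ (oddExp m ℕ.+ suc (double m)) ≡ oddExp (suc m)
  oddExp-step m = begin
    double N ℕ.+ (oddExp m ℕ.+ suc (double m))
      ≡⟨ cong₂ (λ a b → a ℕ.+ (oddExp m ℕ.+ suc b)) (double≡ N) (double≡ m) ⟩
    N ℕ.+ N ℕ.+ (oddExp m ℕ.+ suc (m ℕ.+ m))
      ≡⟨ cong (λ n → suc n ℕ.+ suc n ℕ.+ (oddExp m ℕ.+ suc (m ℕ.+ m))) (double≡ (suc m)) ⟩
    suc (suc m ℕ.+ suc m) ℕ.+ suc (suc m ℕ.+ suc m) ℕ.+ (suc m ℕ.* suc (3 ℕ.* m) ℕ.+ suc (m ℕ.+ m))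
      ≡⟨ arithmetic m ⟩
    suc (suc m) ℕ.* suc (3 ℕ.* suc m)
      ∎
    where
    open ≡-Reasoning
    N : ℕ
    N = suc (double (suc m))
    arithmetic : ∀ m → suc (suc m ℕ.+ suc m) ℕ.+ suc (suc m ℕ.+ suc m) ℕ.+ (suc m ℕ.* suc (3 ℕ.* m) ℕ.+ suc (m ℕ.+ m))
                       ≡ suc (suc m) ℕ.* suc (3 ℕ.* suc m)
    arithmetic = ℕ-solve-∀

  -- ∏_{i<2m+2} (q^{2m+1} - q^{2i}) = (-1)^{m+1} q^{(m+1)(3m+1)} (q;q²)_{m+1}²: the factors with
  -- 2i < 2m + 1 and those with 2i > 2m + 1 each contribute (q;q²)_{m+1} up to a monomial.
  rotheProd-odd : ∀ m → rotheProd (q^ suc (double m)) (double (suc m)) ≈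
                        const (sgn (suc m)) ⊛ (q^ oddExp m ⊛ (oddPoch (suc m) ⊛ oddPoch (suc m)))
  rotheProd-odd zero = ≈-trans (⊛-congʳ _ (⊖-congʳ (q^ 1) (q^-+ 1 1)))
    (solve 1 (λ x → (:const 1ℤ :* (x :- :const 1ℤ)) :* (x :- x :* x) :=
       :const (- 1ℤ) :* (x :* ((:const 1ℤ :* (:const 1ℤ :- x)) :* (:const 1ℤ :* (:const 1ℤ :- x))))) ≈-refl (q^ 1))
  rotheProd-odd (suc m) = begin
    rotheProd y (suc N)
      ≈⟨ rotheProd-cong (suc N) (q^-+ 2 c) ⟩
    rotheProd (q^ 2 ⊛ q^ c) (suc N)
      ≈⟨ rotheProd-shift (q^ c) N ⟩
    (q^ 2 ⊛ q^ c ⊖ 1S) ⊛ (q^ double N ⊛ (rotheProd (q^ c) (double (suc m)) ⊛ (q^ c ⊖ q^ double (double (suc m)))))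
      ≈⟨ ⊛-cong (⊕-cong (≈-sym (q^-+ 2 c)) ≈-refl) (⊛-congʳ (q^ double N) (⊛-cong (rotheProd-odd m) lastFactor)) ⟩
    (y ⊖ 1S) ⊛ (q^ double N ⊛ ((s ⊛ (q^ oddExp m ⊛ (O ⊛ O))) ⊛ (q^ c ⊛ (1S ⊖ y))))
      ≈⟨ regroup y (q^ double N) s (q^ oddExp m) O (q^ c) ⟩
    ⊝ s ⊛ ((q^ double N ⊛ (q^ oddExp m ⊛ q^ c)) ⊛ ((O ⊛ (1S ⊖ y)) ⊛ (O ⊛ (1S ⊖ y))))
      ≈⟨ ⊛-cong (≈-sym (const-neg (sgn (suc m)))) (⊛-congˡ _ monomial) ⟩
    const (sgn (suc (suc m))) ⊛ (q^ oddExp (suc m) ⊛ (oddPoch (suc (suc m)) ⊛ oddPoch (suc (suc m))))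
      ∎
    where
    open ≈-Reasoning
    c N : ℕ
    c = suc (double m)
    N = suc (double (suc m))
    y s O : Series
    y = q^ suc (double (suc m))
    s = const (sgn (suc m))
    O = oddPoch (suc m)
    lastFactor : q^ c ⊖ q^ double (double (suc m)) ≈ q^ c ⊛ (1S ⊖ y)
    lastFactor = ≈-trans (⊖-congʳ (q^ c) (≈-trans (q^-≡ (double-double m)) (q^-+ c (suc (suc c)))))
      (solve 2 (λ a b → a :- a :* b := a :* (:const 1ℤ :- b)) ≈-refl (q^ c) y)
    monomial : q^ double N ⊛ (q^ oddExp m ⊛ q^ c) ≈ q^ oddExp (suc m)
    monomial = ≈-trans (⊛-congʳ (q^ double N) (≈-sym (q^-+ (oddExp m) c)))
      (≈-trans (≈-sym (q^-+ (double N) (oddExp m ℕ.+ c))) (q^-≡ (oddExp-step m)))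
    regroup : ∀ y D s F O C → (y ⊖ 1S) ⊛ (D ⊛ ((s ⊛ (F ⊛ (O ⊛ O))) ⊛ (C ⊛ (1S ⊖ y)))) ≈
                             ⊝ s ⊛ ((D ⊛ (F ⊛ C)) ⊛ ((O ⊛ (1S ⊖ y)) ⊛ (O ⊛ (1S ⊖ y))))
    regroup = solve 6 (λ y D s F O C →
      (y :- :const 1ℤ) :* (D :* ((s :* (F :* (O :* O))) :* (C :* (:const 1ℤ :- y)))) :=
      (:- s) :* ((D :* (F :* C)) :* ((O :* (:const 1ℤ :- y)) :* (O :* (:const 1ℤ :- y))))) ≈-refl

  q^-power : ∀ c k → q^ c ⊛^ k ≈ q^ (k ℕ.* c)
  q^-power c zero    = ≈-refl
  q^-power c (suc k) = ≈-trans (⊛-congˡ (q^ c) (q^-power c k))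
    (≈-trans (≈-sym (q^-+ (k ℕ.* c) c)) (q^-≡ (ℕₚ.+-comm (k ℕ.* c) c)))

  rotheTerm-factor : ∀ c N j {s₁ s₂ F e} → sgn j ≡ s₁ * s₂ → tri₂ j ℕ.+ (N ∸ j) ℕ.* c ≡ F ℕ.+ e →
    rotheTerm (q^ c) N j ≈ const s₁ ⊛ (q^ F ⊛ (const s₂ ⊛ (q^ e ⊛ binom₂ N j)))
  rotheTerm-factor c N j {s₁} {s₂} {F} {e} sign exponent = begin
    const (sgn j) ⊛ (q^ tri₂ j ⊛ (binom₂ N j ⊛ q^ c ⊛^ (N ∸ j)))
      ≈⟨ ⊛-cong (≈-trans (≈-reflexive (cong const sign)) (const-* s₁ s₂))
                (⊛-congʳ (q^ tri₂ j) (⊛-congʳ (binom₂ N j) (q^-power c (N ∸ j)))) ⟩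
    (const s₁ ⊛ const s₂) ⊛ (q^ tri₂ j ⊛ (binom₂ N j ⊛ q^ ((N ∸ j) ℕ.* c)))
      ≈⟨ regroup (const s₁) (const s₂) (q^ tri₂ j) (binom₂ N j) (q^ ((N ∸ j) ℕ.* c)) ⟩
    const s₁ ⊛ ((q^ tri₂ j ⊛ q^ ((N ∸ j) ℕ.* c)) ⊛ (const s₂ ⊛ binom₂ N j))
      ≈⟨ ⊛-congʳ (const s₁) (⊛-congˡ _ (≈-trans (≈-sym (q^-+ (tri₂ j) ((N ∸ j) ℕ.* c))) (≈-trans (q^-≡ exponent) (q^-+ F e)))) ⟩
    const s₁ ⊛ ((q^ F ⊛ q^ e) ⊛ (const s₂ ⊛ binom₂ N j))
      ≈⟨ ⊛-congʳ (const s₁) (regroup′ (q^ F) (q^ e) (const s₂) (binom₂ N j)) ⟩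
    const s₁ ⊛ (q^ F ⊛ (const s₂ ⊛ (q^ e ⊛ binom₂ N j)))
      ∎
    where
    open ≈-Reasoning
    regroup : ∀ a b x B y → (a ⊛ b) ⊛ (x ⊛ (B ⊛ y)) ≈ a ⊛ ((x ⊛ y) ⊛ (b ⊛ B))
    regroup = solve 5 (λ a b x B y → (a :* b) :* (x :* (B :* y)) := a :* ((x :* y) :* (b :* B))) ≈-refl
    regroup′ : ∀ f e s B → (f ⊛ e) ⊛ (s ⊛ B) ≈ f ⊛ (s ⊛ (e ⊛ B))
    regroup′ = solve 4 (λ f e s B → (f :* e) :* (s :* B) := f :* (s :* (e :* B))) ≈-refl

  sgn-∸ : ∀ n k → k ≤ n → sgn (n ∸ k) ≡ sgn n * sgn k
  sgn-∸ n k k≤n = begin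
    sgn (n ∸ k)                         ≡⟨ ℤₚ.*-identityʳ (sgn (n ∸ k)) ⟨
    sgn (n ∸ k) * 1ℤ                    ≡⟨ cong (sgn (n ∸ k) *_) (sgn-square k) ⟨
    sgn (n ∸ k) * (sgn k * sgn k)       ≡⟨ ℤₚ.*-assoc (sgn (n ∸ k)) (sgn k) (sgn k) ⟨
    sgn (n ∸ k) * sgn k * sgn k         ≡⟨ cong (_* sgn k) (sgn-+ (n ∸ k) k) ⟨
    sgn (n ∸ k ℕ.+ k) * sgn k           ≡⟨ cong (λ t → sgn t * sgn k) (ℕₚ.m∸n+n≡m k≤n) ⟩
    sgn n * sgn k                       ∎
    where open ≡-Reasoning

  sgn-cancel : ∀ n {f g} → const (sgn n) ⊛ f ≈ const (sgn n) ⊛ g → f ≈ g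
  sgn-cancel n {f} {g} sf≈sg i = begin
    f i                        ≡⟨ unsign (f i) ⟨
    sgn n * (sgn n * f i)      ≡⟨ cong (sgn n *_) (trans (sym (const-⊛ (sgn n) f i)) (trans (sf≈sg i) (const-⊛ (sgn n) g i))) ⟩
    sgn n * (sgn n * g i)      ≡⟨ unsign (g i) ⟩
    g i                        ∎
    where
    open ≡-Reasoning
    unsign : ∀ x → sgn n * (sgn n * x) ≡ x
    unsign x = trans (sym (ℤₚ.*-assoc (sgn n) (sgn n) x)) (trans (cong (_* x) (sgn-square n)) (ℤₚ.*-identityˡ x))

  -- The exponents of the two halves of Rothe's expansion at z = q^{2m+1}, N = 2m + 2.
  double-∸ : ∀ j k → double (j ℕ.+ k) ∸ j ≡ k ℕ.+ (j ℕ.+ k)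
  double-∸ j k = trans (cong (_∸ j) (trans (double≡ (j ℕ.+ k)) (ℕₚ.+-assoc j k (j ℕ.+ k))))
                       (ℕₚ.m+n∸m≡n j (k ℕ.+ (j ℕ.+ k)))

  lowerExponent : ∀ j k m → j ℕ.+ k ≡ suc m →
    tri₂ j ℕ.+ (double (suc m) ∸ j) ℕ.* suc (double m) ≡ oddExp m ℕ.+ k ℕ.* k
  lowerExponent zero    .(suc m) m refl rewrite double≡ m = arithmetic m
    where
    arithmetic : ∀ m → suc (suc (m ℕ.+ m)) ℕ.* suc (m ℕ.+ m) ≡ suc m ℕ.* suc (3 ℕ.* m) ℕ.+ suc m ℕ.* suc m
    arithmetic = ℕ-solve-∀
  lowerExponent (suc i) k .(i ℕ.+ k) refl
    rewrite double-∸ (suc i) k | double≡ (i ℕ.+ k) = arithmetic i k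
    where
    arithmetic : ∀ i k → suc i ℕ.* i ℕ.+ (k ℕ.+ suc (i ℕ.+ k)) ℕ.* suc ((i ℕ.+ k) ℕ.+ (i ℕ.+ k))
                         ≡ suc (i ℕ.+ k) ℕ.* suc (3 ℕ.* (i ℕ.+ k)) ℕ.+ k ℕ.* k
    arithmetic = ℕ-solve-∀

  upperGap : ∀ k t → double (suc (k ℕ.+ t)) ∸ suc (suc (k ℕ.+ t) ℕ.+ k) ≡ t
  upperGap k t = begin
    double (suc (k ℕ.+ t)) ∸ suc (suc (k ℕ.+ t) ℕ.+ k)         ≡⟨ cong₂ _∸_ (double≡ (suc (k ℕ.+ t))) (sym (ℕₚ.+-suc (suc (k ℕ.+ t)) k)) ⟩
    (suc (k ℕ.+ t) ℕ.+ suc (k ℕ.+ t)) ∸ (suc (k ℕ.+ t) ℕ.+ suc k) ≡⟨ ℕₚ.[m+n]∸[m+o]≡n∸o (suc (k ℕ.+ t)) (suc (k ℕ.+ t)) (suc k) ⟩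
    (k ℕ.+ t) ∸ k                                                ≡⟨ ℕₚ.m+n∸m≡n k t ⟩
    t                                                            ∎
    where open ≡-Reasoning

  upperExponent : ∀ m k → k ≤ m →
    tri₂ (suc (suc m ℕ.+ k)) ℕ.+ (double (suc m) ∸ suc (suc m ℕ.+ k)) ℕ.* suc (double m) ≡ oddExp m ℕ.+ suc k ℕ.* suc k
  upperExponent m k k≤m with ℕₚ.m≤n⇒∃[o]m+o≡n k≤m
  ... | t , refl rewrite upperGap k t | double≡ (k ℕ.+ t) = arithmetic k t
    where
    arithmetic : ∀ k t → suc (suc (k ℕ.+ t) ℕ.+ k) ℕ.* (suc (k ℕ.+ t) ℕ.+ k) ℕ.+ t ℕ.* suc ((k ℕ.+ t) ℕ.+ (k ℕ.+ t))
                         ≡ suc (k ℕ.+ t) ℕ.* suc (3 ℕ.* (k ℕ.+ t)) ℕ.+ suc k ℕ.* suc k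
    arithmetic = ℕ-solve-∀

  ∑-split : ∀ n m T → ∑ (suc (n ℕ.+ m)) T ≈ ∑ n (λ k → T (n ∸ k)) ⊕ ∑ m (λ k → T (suc (n ℕ.+ k)))
  ∑-split n m T x = trans (sumℤ-split n m (λ j → T j x))
                          (cong (_+ ∑ m (λ k → T (suc (n ℕ.+ k))) x) (sumℤ-reverse n (λ j → T j x)))

  -- The finite form of Gauss's identity: for n = m + 1 and N = 2n,
  --   (q;q²)_n² = Σ_{k≤n} (-1)^k q^{k²} [N, n-k] + Σ_{k<n} (-1)^{k+1} q^{(k+1)²} [N, n+1+k],
  -- obtained from Rothe's theorem at z = q^{2m+1} by factoring (-1)^n q^{(m+1)(3m+1)} out of every term.
  lowerGaussTerm upperGaussTerm : ℕ → ℕ → Series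
  lowerGaussTerm m k = const (sgn k) ⊛ (q^ (k ℕ.* k) ⊛ binom₂ (double (suc m)) (suc m ∸ k))
  upperGaussTerm m k = const (sgn (suc k)) ⊛ (q^ (suc k ℕ.* suc k) ⊛ binom₂ (double (suc m)) (suc (suc m ℕ.+ k)))

  finiteGauss : ∀ m → oddPoch (suc m) ⊛ oddPoch (suc m) ≈ ∑ (suc m) (lowerGaussTerm m) ⊕ ∑ m (upperGaussTerm m)
  finiteGauss m = sgn-cancel n (q^-cancel (oddExp m) (begin
    q^ F ⊛ (s ⊛ O²)
      ≈⟨ swap (q^ F) s O² ⟩
    s ⊛ (q^ F ⊛ O²)
      ≈⟨ rotheProd-odd m ⟨
    rotheProd (q^ c) N
      ≈⟨ rothe (q^ c) N ⟩
    ∑ N T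
      ≈⟨ ≈-reflexive (cong (λ t → ∑ (suc (suc t)) T) (double≡ m)) ⟩
    ∑ (suc (n ℕ.+ m)) T
      ≈⟨ ∑-split n m T ⟩
    ∑ n (λ k → T (n ∸ k)) ⊕ ∑ m (λ k → T (suc (n ℕ.+ k)))
      ≈⟨ ⊕-cong (∑-cong n lower) (∑-cong m upper) ⟩
    ∑ n (λ k → s ⊛ (q^ F ⊛ lowerGaussTerm m k)) ⊕ ∑ m (λ k → s ⊛ (q^ F ⊛ upperGaussTerm m k))
      ≈⟨ ≈-sym (⊕-cong (factorOut (lowerGaussTerm m) n) (factorOut (upperGaussTerm m) m)) ⟩
    s ⊛ (q^ F ⊛ ∑ n (lowerGaussTerm m)) ⊕ s ⊛ (q^ F ⊛ ∑ m (upperGaussTerm m))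
      ≈⟨ distrib s (q^ F) (∑ n (lowerGaussTerm m)) (∑ m (upperGaussTerm m)) ⟩
    q^ F ⊛ (s ⊛ (∑ n (lowerGaussTerm m) ⊕ ∑ m (upperGaussTerm m)))
      ∎))
    where
    open ≈-Reasoning
    n c N F : ℕ
    n = suc m
    c = suc (double m)
    N = double n
    F = oddExp m
    s O² : Series
    s = const (sgn n)
    O² = oddPoch n ⊛ oddPoch n
    T : ℕ → Series
    T = rotheTerm (q^ c) N
    lower : ∀ k → k ≤ n → T (n ∸ k) ≈ s ⊛ (q^ F ⊛ lowerGaussTerm m k)
    lower k k≤n = rotheTerm-factor c N (n ∸ k) {F = F} {e = k ℕ.* k} (sgn-∸ n k k≤n) (lowerExponent (n ∸ k) k m (ℕₚ.m∸n+n≡m k≤n))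
    upper : ∀ k → k ≤ m → T (suc (n ℕ.+ k)) ≈ s ⊛ (q^ F ⊛ upperGaussTerm m k)
    upper k k≤m = rotheTerm-factor c N (suc (n ℕ.+ k)) {F = F} {e = suc k ℕ.* suc k} (trans (cong sgn (sym (ℕₚ.+-suc n k))) (sgn-+ n (suc k)))
                                   (upperExponent m k k≤m)
    factorOut : ∀ W k → s ⊛ (q^ F ⊛ ∑ k W) ≈ ∑ k (λ j → s ⊛ (q^ F ⊛ W j))
    factorOut W k = ≈-trans (⊛-congʳ s (⊛-∑ k W (q^ F))) (⊛-∑ k (λ j → q^ F ⊛ W j) s)
    swap : ∀ x s O → x ⊛ (s ⊛ O) ≈ s ⊛ (x ⊛ O)
    swap = solve 3 (λ x s O → x :* (s :* O) := s :* (x :* O)) ≈-refl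
    distrib : ∀ s x a b → s ⊛ (x ⊛ a) ⊕ s ⊛ (x ⊛ b) ≈ x ⊛ (s ⊛ (a ⊕ b))
    distrib = solve 4 (λ s x a b → s :* (x :* a) :+ s :* (x :* b) := x :* (s :* (a :+ b))) ≈-refl

  i<suc[double] : ∀ i → i < suc (double i)
  i<suc[double] i = s≤s (subst (i ≤_) (sym (double≡ i)) (ℕₚ.m≤m+n i i))

  i<double[suc] : ∀ i → i < double (suc i)
  i<double[suc] i = ℕₚ.<-trans (i<suc[double] i) ℕₚ.≤-refl

  evenPoch-const : ∀ M → evenPoch M 0 ≡ 1ℤ
  evenPoch-const M = poch-const (λ i → double (suc i)) M i<double[suc]

  evenPoch-≈[] : ∀ {M N} → M ≤ N → evenPoch N ≈[ M ] evenPoch M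
  evenPoch-≈[] = poch-≈[] (λ i → double (suc i)) i<double[suc]

  oddPoch-≈[] : ∀ {M N} → M ≤ N → oddPoch N ≈[ M ] oddPoch M
  oddPoch-≈[] = poch-≈[] (λ i → suc (double i)) i<suc[double]

  -- [N, j] → 1/(q²;q²)_∞ as j, N - j → ∞: modulo q^M, [N, j] (q²;q²)_M ≡ 1 once j, N - j ≥ M.
  binom₂-limit : ∀ {M} N j → j ≤ N → M ≤ j → M ≤ N ∸ j → binom₂ N j ⊛ evenPoch M ≈[ M ] 1S
  binom₂-limit {M} N j j≤N M≤j M≤N∸j = ⊛-cancelʳ-≈[] (evenPoch-const M)
    (≈[]-trans (⊛-cong-≈[] (⊛-cong-≈[] (≈[]-refl {binom₂ N j}) (≈[]-sym (evenPoch-≈[] M≤j))) (≈[]-sym (evenPoch-≈[] M≤N∸j)))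
    (≈[]-trans (≈⇒≈[] (binom₂-evenPoch N j j≤N))
    (≈[]-trans (evenPoch-≈[] (ℕₚ.≤-trans M≤j j≤N)) (≈⇒≈[] (≈-sym (⊛-identityˡ (evenPoch M)))))))

  monomial-≈[] : ∀ {M} s a {h} → (a < M → h ≈[ M ] 1S) → const s ⊛ (q^ a ⊛ h) ≈[ M ] const s ⊛ (q^ a ⊛ 1S)
  monomial-≈[] {M} s a {h} h≈1 with a ℕ.<? M
  ... | yes a<M = ⊛-cong-≈[] (≈[]-refl {const s}) (⊛-cong-≈[] (≈[]-refl {q^ a}) (h≈1 a<M))
  ... | no a≮M = ≈[]-trans (highDegree h) (≈[]-sym (highDegree 1S))
    where
    highDegree : ∀ h → const s ⊛ (q^ a ⊛ h) ≈[ M ] 0S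
    highDegree h = ≈[]-trans (≈⇒≈[] (swap (const s) (q^ a) h)) (q^-⊛-≈[] (const s ⊛ h) (ℕₚ.≮⇒≥ a≮M))
      where
      swap : ∀ s a h → s ⊛ (a ⊛ h) ≈ a ⊛ (s ⊛ h)
      swap = solve 3 (λ s a h → s :* (a :* h) := a :* (s :* h)) ≈-refl

  gaussTerm-limit : ∀ {M} s a g → (a < M → g ⊛ evenPoch M ≈[ M ] 1S) →
                    (const s ⊛ (q^ a ⊛ g)) ⊛ evenPoch M ≈[ M ] const s ⊛ (q^ a ⊛ 1S)
  gaussTerm-limit {M} s a g g-limit =
    ≈[]-trans (≈⇒≈[] (reassociate (const s) (q^ a) g (evenPoch M))) (monomial-≈[] s a g-limit)
    where
    reassociate : ∀ s a g E → (s ⊛ (a ⊛ g)) ⊛ E ≈ s ⊛ (a ⊛ (g ⊛ E))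
    reassociate = solve 4 (λ s a g E → (s :* (a :* g)) :* E := s :* (a :* (g :* E))) ≈-refl

  τ : Series
  τ x = sumℤ x (λ k → sgn (suc k) * (q^ (suc k ℕ.* suc k)) x)

  φ : Series
  φ = 1S ⊕ (τ ⊕ τ)

  -- Only the terms with k < x contribute to the coefficient τ x.
  τ-coeff : ∀ m x → x ≤ m → sumℤ m (λ k → sgn (suc k) * (q^ (suc k ℕ.* suc k)) x) ≡ τ x
  τ-coeff m x x≤m = trans (cong (λ t → sumℤ t term) (sym (ℕₚ.m+[n∸m]≡n x≤m)))
    (sumℤ-extend x (m ∸ x) term (λ k x<k → trans (cong (sgn (suc k) *_)
       (q^-zero (suc k ℕ.* suc k) x (ℕₚ.<-≤-trans x<k (ℕₚ.≤-trans (ℕₚ.n≤1+n k) (ℕₚ.m≤m*n (suc k) (suc k))))))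
       (ℤₚ.*-zeroʳ (sgn (suc k)))))
    where
    term : ℕ → ℤ
    term k = sgn (suc k) * (q^ (suc k ℕ.* suc k)) x

  -- The truncations of φ = Σ_{k∈ℤ} (-1)^k q^{k²} that the finite Gauss identity produces in the limit.
  φ-partialSum : ∀ m x → x ≤ m →
    (∑ (suc m) (λ k → const (sgn k) ⊛ (q^ (k ℕ.* k) ⊛ 1S)) ⊕ ∑ m (λ k → const (sgn (suc k)) ⊛ (q^ (suc k ℕ.* suc k) ⊛ 1S))) x
    ≡ φ x
  φ-partialSum m x x≤m = begin
    sumℤ (suc m) (λ k → (const (sgn k) ⊛ (q^ (k ℕ.* k) ⊛ 1S)) x) + sumℤ m (λ k → (const (sgn (suc k)) ⊛ (q^ (suc k ℕ.* suc k) ⊛ 1S)) x)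
      ≡⟨ cong₂ _+_ (trans (sumℤ-cong (suc m) (λ k _ → monomialCoeff (sgn k) (k ℕ.* k))) (sumℤ-head m _))
                   (sumℤ-cong m (λ k _ → monomialCoeff (sgn (suc k)) (suc k ℕ.* suc k))) ⟩
    (1ℤ * 1S x + sumℤ m τTerm) + sumℤ m τTerm
      ≡⟨ cong (λ t → (1ℤ * 1S x + t) + t) (τ-coeff m x x≤m) ⟩
    (1ℤ * 1S x + τ x) + τ x
      ≡⟨ regroup (1S x) (τ x) ⟩
    φ x
      ∎
    where
    open ≡-Reasoning
    monomialCoeff : ∀ s a → (const s ⊛ (q^ a ⊛ 1S)) x ≡ s * (q^ a) x
    monomialCoeff s a = trans (const-⊛ s (q^ a ⊛ 1S) x) (cong (s *_) (⊛-identityʳ (q^ a) x))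
    τTerm : ℕ → ℤ
    τTerm k = sgn (suc k) * (q^ (suc k ℕ.* suc k)) x
    regroup : ∀ a b → (1ℤ * a + b) + b ≡ a + (b + b)
    regroup = solve-∀

  -- Gauss's product formula φ = (q;q²)_∞² (q²;q²)_∞, modulo q^M: the limit of the finite form.
  gaussProduct : ∀ M → φ ≈[ M ] oddPoch M ⊛ oddPoch M ⊛ evenPoch M
  gaussProduct M = ≈[]-sym (begin
    oddPoch M ⊛ oddPoch M ⊛ E
      ≈⟨ ⊛-cong-≈[] (⊛-cong-≈[] (≈[]-sym (oddPoch-≈[] M≤n)) (≈[]-sym (oddPoch-≈[] M≤n))) (≈[]-refl {E}) ⟩
    oddPoch n ⊛ oddPoch n ⊛ E
      ≈⟨ ≈⇒≈[] (⊛-congˡ E (finiteGauss m)) ⟩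
    (∑ n (lowerGaussTerm m) ⊕ ∑ m (upperGaussTerm m)) ⊛ E
      ≈⟨ ≈⇒≈[] (≈-trans (⊛-distribʳ E (∑ n (lowerGaussTerm m)) (∑ m (upperGaussTerm m)))
                        (⊕-cong (∑-⊛ n (lowerGaussTerm m) E) (∑-⊛ m (upperGaussTerm m) E))) ⟩
    ∑ n (λ k → lowerGaussTerm m k ⊛ E) ⊕ ∑ m (λ k → upperGaussTerm m k ⊛ E)
      ≈⟨ ⊕-cong-≈[] (∑-cong-≈[] n (λ k k≤n → gaussTerm-limit _ (k ℕ.* k) _ (λ k²<M → lowerLimit k k≤n (square-< k k²<M))))
                    (∑-cong-≈[] m (λ k k≤m → gaussTerm-limit _ (suc k ℕ.* suc k) _ (λ k²<M → upperLimit k k≤m (square-< (suc k) k²<M)))) ⟩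
    ∑ n (λ k → const (sgn k) ⊛ (q^ (k ℕ.* k) ⊛ 1S)) ⊕ ∑ m (λ k → const (sgn (suc k)) ⊛ (q^ (suc k ℕ.* suc k) ⊛ 1S))
      ≈⟨ (λ x x<M → φ-partialSum m x (ℕₚ.≤-trans (ℕₚ.<⇒≤ x<M) (ℕₚ.m≤m+n M M))) ⟩
    φ
      ∎)
    where
    open import Relation.Binary.Reasoning.Setoid (≈[]-setoid M)
    m n N : ℕ
    m = M ℕ.+ M
    n = suc m
    N = double n
    E : Series
    E = evenPoch M
    M≤n : M ≤ n
    M≤n = ℕₚ.≤-trans (ℕₚ.m≤m+n M M) (ℕₚ.n≤1+n m)
    N≡n+n : N ≡ n ℕ.+ n
    N≡n+n = double≡ n
    square-< : ∀ k → k ℕ.* k < M → k < M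
    square-< zero    k²<M = k²<M
    square-< (suc k) k²<M = ℕₚ.≤-<-trans (ℕₚ.m≤m*n (suc k) (suc k)) k²<M
    n≤N : n ≤ N
    n≤N = subst (n ≤_) (sym N≡n+n) (ℕₚ.m≤m+n n n)
    N∸n≡n : N ∸ n ≡ n
    N∸n≡n = trans (cong (_∸ n) N≡n+n) (ℕₚ.m+n∸n≡m n n)
    lowerLimit : ∀ k → k ≤ n → k < M → binom₂ N (n ∸ k) ⊛ E ≈[ M ] 1S
    lowerLimit k k≤n k<M = binom₂-limit N (n ∸ k) (ℕₚ.≤-trans (ℕₚ.m∸n≤m n k) n≤N)
      (ℕₚ.m+n≤o⇒m≤o∸n M (ℕₚ.≤-trans (ℕₚ.+-monoʳ-≤ M (ℕₚ.<⇒≤ k<M)) (ℕₚ.n≤1+n m)))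
      (ℕₚ.≤-trans M≤n (subst (_≤ N ∸ (n ∸ k)) N∸n≡n (ℕₚ.∸-monoʳ-≤ N (ℕₚ.m∸n≤m n k))))
    upperLimit : ∀ k → k ≤ m → suc k < M → binom₂ N (suc (n ℕ.+ k)) ⊛ E ≈[ M ] 1S
    upperLimit k k≤m k<M = binom₂-limit N (suc (n ℕ.+ k))
      (subst (_≤ N) (ℕₚ.+-suc n k) (subst (n ℕ.+ suc k ≤_) (sym N≡n+n) (ℕₚ.+-monoʳ-≤ n (s≤s k≤m))))
      (ℕₚ.≤-trans M≤n (ℕₚ.≤-trans (ℕₚ.m≤m+n n k) (ℕₚ.n≤1+n (n ℕ.+ k))))
      (ℕₚ.m+n≤o⇒m≤o∸n M (subst₂ _≤_ (rearrange M n k) (sym N≡n+n)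
         (ℕₚ.+-monoʳ-≤ n (s≤s (ℕₚ.+-monoʳ-≤ M (ℕₚ.≤-trans (ℕₚ.n≤1+n k) (ℕₚ.<⇒≤ k<M)))))))
      where
      rearrange : ∀ M n k → n ℕ.+ suc (M ℕ.+ k) ≡ M ℕ.+ suc (n ℕ.+ k)
      rearrange = ℕ-solve-∀

  multSum-below : ∀ g p f r → r < p → multSum g p f r ≡ 0
  multSum-below g p zero    r _   = refl
  multSum-below g p (suc f) r r<p with p ≤ᵇ r in p≤ᵇr
  ... | false = refl
  ... | true  = ⊥-elim (ℕₚ.<⇒≱ r<p (ℕₚ.≤ᵇ⇒≤ p r (subst Bool.T (sym p≤ᵇr) tt)))

  multSum-unfold : ∀ g p f r → p ≤ r → multSum g p (suc f) r ≡ g (r ∸ p) ℕ.+ multSum g p f (r ∸ p)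
  multSum-unfold g p f r p≤r with p ≤ᵇ r | ℕₚ.≤⇒≤ᵇ p≤r
  ... | true | _ = refl

  multSum-fuel : ∀ g k f f′ r → r ≤ f → r ≤ f′ → multSum g (suc k) f r ≡ multSum g (suc k) f′ r
  multSum-fuel g k zero    zero     r _ _ = refl
  multSum-fuel g k zero    (suc f′) .zero z≤n _ = refl
  multSum-fuel g k (suc f) zero     .zero _ z≤n = refl
  multSum-fuel g k (suc f) (suc f′) r r≤f r≤f′ with suc k ≤ᵇ r
  ... | false = refl
  ... | true  = cong (g (r ∸ suc k) ℕ.+_) (multSum-fuel g k f f′ (r ∸ suc k) (step r≤f) (step r≤f′))
    where
    step : ∀ {f} → r ≤ suc f → r ∸ suc k ≤ f
    step r≤1+f = ℕₚ.≤-trans (ℕₚ.∸-monoʳ-≤ r (s≤s (z≤n {k}))) (ℕₚ.∸-monoˡ-≤ 1 r≤1+f)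

  multSum-step : ∀ g k t → multSum g (suc k) (suc k ℕ.+ t) (suc k ℕ.+ t) ≡ g t ℕ.+ multSum g (suc k) t t
  multSum-step g k t = trans (multSum-unfold g (suc k) (k ℕ.+ t) (suc k ℕ.+ t) (s≤s (ℕₚ.m≤m+n k t)))
    (trans (cong (λ x → g x ℕ.+ multSum g (suc k) (k ℕ.+ t) x) (ℕₚ.m+n∸m≡n k t))
           (cong (g t ℕ.+_) (multSum-fuel g k (k ℕ.+ t) t t (ℕₚ.m≤n+m t k) ℕₚ.≤-refl)))

  -- Parts larger than n cannot occur in an overpartition of n.
  ovBounded-stable : ∀ k n → n ≤ k → ovBounded (suc k) n ≡ ovBounded k n
  ovBounded-stable k n n≤k rewrite multSum-below (ovBounded k) (suc k) n n (s≤s n≤k) = ℕₚ.+-identityʳ _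

  pbar≡ovBounded : ∀ K n → n ≤ K → pbar n ≡ ovBounded K n
  pbar≡ovBounded K n n≤K with ℕₚ.m≤n⇒∃[o]m+o≡n n≤K
  ... | d , refl = sym (extra d)
    where
    extra : ∀ d → ovBounded (n ℕ.+ d) n ≡ ovBounded n n
    extra zero    = cong (λ K → ovBounded K n) (ℕₚ.+-identityʳ n)
    extra (suc d) rewrite ℕₚ.+-suc n d = trans (ovBounded-stable (n ℕ.+ d) n (ℕₚ.m≤m+n n d)) (extra d)

  -- Allowing parts of size p = k + 1: F_{k+1}(p + t) = F_k(p + t) + F_k(t) + F_{k+1}(t),
  -- i.e. (1 - q^p) F_{k+1} = (1 + q^p) F_k.
  ovBounded-step : ∀ k t → ovBounded (suc k) (suc k ℕ.+ t) ≡ ovBounded k (suc k ℕ.+ t) ℕ.+ ovBounded k t ℕ.+ ovBounded (suc k) t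
  ovBounded-step k t rewrite multSum-step (ovBounded k) k t = arithmetic (ovBounded k (suc k ℕ.+ t)) (ovBounded k t) (multSum (ovBounded k) (suc k) t t)
    where
    arithmetic : ∀ a b s → a ℕ.+ 2 ℕ.* (b ℕ.+ s) ≡ a ℕ.+ b ℕ.+ (b ℕ.+ 2 ℕ.* s)
    arithmetic = ℕ-solve-∀

  ovSeries : ℕ → Series
  ovSeries K n = + ovBounded K n

  ovSeries-step : ∀ k → ovSeries (suc k) ⊛ 1-q^ (suc k) ≈ ovSeries k ⊛ (1S ⊕ q^ suc k)
  ovSeries-step k = ≈-trans (expand⁻ (ovSeries (suc k)) (q^ p)) (≈-trans coefficients (≈-sym (expand⁺ (ovSeries k) (q^ p))))
    where
    p : ℕ
    p = suc k
    expand⁻ : ∀ f x → f ⊛ (1S ⊖ x) ≈ f ⊖ x ⊛ f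
    expand⁻ = solve 2 (λ f x → f :* (:const 1ℤ :- x) := f :- x :* f) ≈-refl
    expand⁺ : ∀ f x → f ⊛ (1S ⊕ x) ≈ f ⊕ x ⊛ f
    expand⁺ = solve 2 (λ f x → f :* (:const 1ℤ :+ x) := f :+ x :* f) ≈-refl
    cancel : ∀ a b c → + (a ℕ.+ b ℕ.+ c) + - (+ c) ≡ + a + + b
    cancel a b c = trans (cong (_+ - (+ c)) (trans (ℤₚ.pos-+ (a ℕ.+ b) c) (cong (_+ + c) (ℤₚ.pos-+ a b))))
                         (additive (+ a) (+ b) (+ c))
      where
      additive : ∀ x y z → x + y + z + - z ≡ x + y
      additive = solve-∀
    coefficients : ovSeries (suc k) ⊖ q^ p ⊛ ovSeries (suc k) ≈ ovSeries k ⊕ q^ p ⊛ ovSeries k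
    coefficients n with ℕₚ.<-≤-connex n p
    ... | inj₁ n<p = cong₂ _+_ (cong +_ (ovBounded-stable k n (ℕₚ.≤-pred n<p)))
                              (trans (cong -_ (q^-⊛-low p (ovSeries (suc k)) n n<p)) (sym (q^-⊛-low p (ovSeries k) n n<p)))
    ... | inj₂ p≤n with ℕₚ.m≤n⇒∃[o]m+o≡n p≤n
    ...   | t , refl = begin
      + ovBounded (suc k) (p ℕ.+ t) + - (q^ p ⊛ ovSeries (suc k)) (p ℕ.+ t)
        ≡⟨ cong₂ (λ a b → + a + - b) (ovBounded-step k t) (q^-⊛-high p (ovSeries (suc k)) t) ⟩
      + (ovBounded k (p ℕ.+ t) ℕ.+ ovBounded k t ℕ.+ ovBounded (suc k) t) + - (+ ovBounded (suc k) t)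
        ≡⟨ cancel (ovBounded k (p ℕ.+ t)) (ovBounded k t) (ovBounded (suc k) t) ⟩
      + ovBounded k (p ℕ.+ t) + + ovBounded k t
        ≡⟨ cong (λ x → + ovBounded k (p ℕ.+ t) + x) (q^-⊛-high p (ovSeries k) t) ⟨
      + ovBounded k (p ℕ.+ t) + (q^ p ⊛ ovSeries k) (p ℕ.+ t)
        ∎
      where open ≡-Reasoning

  ovSeries-qPoch : ∀ K → ovSeries K ⊛ qPoch K ≈ qPoch⁺ K
  ovSeries-qPoch zero    = ≈-trans (⊛-identityʳ (ovSeries 0)) empty
    where
    empty : ovSeries 0 ≈ 1S
    empty zero    = refl
    empty (suc n) = refl
  ovSeries-qPoch (suc K) = begin
    ovSeries (suc K) ⊛ (qPoch K ⊛ 1-q^ (suc K))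
      ≈⟨ swap (ovSeries (suc K)) (qPoch K) (1-q^ (suc K)) ⟩
    (ovSeries (suc K) ⊛ 1-q^ (suc K)) ⊛ qPoch K
      ≈⟨ ⊛-congˡ (qPoch K) (ovSeries-step K) ⟩
    (ovSeries K ⊛ (1S ⊕ q^ suc K)) ⊛ qPoch K
      ≈⟨ swap′ (ovSeries K) (1S ⊕ q^ suc K) (qPoch K) ⟩
    (ovSeries K ⊛ qPoch K) ⊛ (1S ⊕ q^ suc K)
      ≈⟨ ⊛-congˡ (1S ⊕ q^ suc K) (ovSeries-qPoch K) ⟩
    qPoch⁺ (suc K)
      ∎
    where
    open ≈-Reasoning
    swap : ∀ o a m → o ⊛ (a ⊛ m) ≈ (o ⊛ m) ⊛ a
    swap = solve 3 (λ o a m → o :* (a :* m) := (o :* m) :* a) ≈-refl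
    swap′ : ∀ o p a → (o ⊛ p) ⊛ a ≈ (o ⊛ a) ⊛ p
    swap′ = solve 3 (λ o p a → (o :* p) :* a := (o :* a) :* p) ≈-refl

  qPoch-const : ∀ M → qPoch M 0 ≡ 1ℤ
  qPoch-const M = poch-const suc M (λ i → ℕₚ.≤-refl)

  qPoch-≈[] : ∀ {M N} → M ≤ N → qPoch N ≈[ M ] qPoch M
  qPoch-≈[] = poch-≈[] suc (λ i → ℕₚ.≤-refl)

  φ-qPoch⁺ : ∀ M → φ ⊛ qPoch⁺ M ≈[ M ] qPoch M
  φ-qPoch⁺ M = ⊛-cancelʳ-≈[] (qPoch-const M) (begin
    (φ ⊛ qPoch⁺ M) ⊛ qPoch M
      ≈⟨ ≈⇒≈[] (≈-trans (⊛-assoc φ (qPoch⁺ M) (qPoch M)) (⊛-congʳ φ (≈-trans (⊛-comm (qPoch⁺ M) (qPoch M)) (qPoch-⊛-qPoch⁺ M)))) ⟩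
    φ ⊛ evenPoch M
      ≈⟨ ⊛-cong-≈[] (gaussProduct M) (≈[]-refl {evenPoch M}) ⟩
    oddPoch M ⊛ oddPoch M ⊛ evenPoch M ⊛ evenPoch M
      ≈⟨ ≈⇒≈[] (≈-trans (regroup (oddPoch M) (evenPoch M)) (≈-sym (⊛-cong (qPoch-double M) (qPoch-double M)))) ⟩
    qPoch (double M) ⊛ qPoch (double M)
      ≈⟨ ⊛-cong-≈[] (qPoch-≈[] M≤2M) (qPoch-≈[] M≤2M) ⟩
    qPoch M ⊛ qPoch M
      ∎)
    where
    open import Relation.Binary.Reasoning.Setoid (≈[]-setoid M)
    M≤2M : M ≤ double M
    M≤2M = subst (M ≤_) (sym (double≡ M)) (ℕₚ.m≤m+n M M)
    regroup : ∀ o e → o ⊛ o ⊛ e ⊛ e ≈ (o ⊛ e) ⊛ (o ⊛ e)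
    regroup = solve 2 (λ o e → o :* o :* e :* e := (o :* e) :* (o :* e)) ≈-refl

  φ-ovSeries : ∀ M → φ ⊛ ovSeries M ≈[ M ] 1S
  φ-ovSeries M = ⊛-cancelʳ-≈[] (qPoch-const M)
    (≈[]-trans (≈⇒≈[] (≈-trans (⊛-assoc φ (ovSeries M) (qPoch M)) (⊛-congʳ φ (ovSeries-qPoch M))))
    (≈[]-trans (φ-qPoch⁺ M) (≈⇒≈[] (≈-sym (⊛-identityˡ (qPoch M))))))

  pbarSeries : Series
  pbarSeries n = + pbar n

  φ-pbar : φ ⊛ pbarSeries ≈ 1S
  φ-pbar x = trans (⊛-cong-≈[] (≈[]-refl {φ}) agree x ℕₚ.≤-refl) (φ-ovSeries (suc x) x ℕₚ.≤-refl)
    where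
    agree : pbarSeries ≈[ suc x ] ovSeries (suc x)
    agree y y<1+x = cong +_ (pbar≡ovBounded (suc x) y (ℕₚ.<⇒≤ y<1+x))

  Even : ℤ → Set
  Even x = Σ ℤ (λ c → x ≡ c + c)

  Even-sum : ∀ n f → (∀ i → i ≤ n → Even (f i)) → Even (sumℤ n f)
  Even-sum zero    f even = even 0 z≤n
  Even-sum (suc n) f even with Even-sum n f (λ i i≤n → even i (ℕₚ.m≤n⇒m≤1+n i≤n)) | even (suc n) ℕₚ.≤-refl
  ... | c , e₁ | d , e₂ = c + d , trans (cong₂ _+_ e₁ e₂) (interchange c d)
    where
    interchange : ∀ c d → (c + c) + (d + d) ≡ (c + d) + (c + d)
    interchange = solve-∀

  parity : ∀ m → Σ ℕ (λ h → m ≡ h ℕ.+ h ⊎ m ≡ suc (h ℕ.+ h))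
  parity zero    = 0 , inj₁ refl
  parity (suc m) with parity m
  ... | h , inj₁ m≡2h   = h , inj₂ (cong suc m≡2h)
  ... | h , inj₂ m≡2h+1 = suc h , inj₁ (trans (cong suc m≡2h+1) (cong suc (sym (ℕₚ.+-suc h h))))

  -- The index j ≤ k and its mirror image about (2k + 1)/2, resp. about k + 1.
  mirror-odd : ∀ j k → j ≤ k → j ℕ.+ suc (k ℕ.+ (k ∸ j)) ≡ suc (k ℕ.+ k)
  mirror-odd j k j≤k with ℕₚ.m≤n⇒∃[o]m+o≡n j≤k
  ... | t , refl rewrite ℕₚ.m+n∸m≡n j t = arithmetic j t
    where
    arithmetic : ∀ j t → j ℕ.+ suc ((j ℕ.+ t) ℕ.+ t) ≡ suc ((j ℕ.+ t) ℕ.+ (j ℕ.+ t))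
    arithmetic = ℕ-solve-∀

  mirror-even : ∀ j k → j ≤ k → j ℕ.+ suc (k ℕ.+ suc (k ∸ j)) ≡ suc k ℕ.+ suc k
  mirror-even j k j≤k with ℕₚ.m≤n⇒∃[o]m+o≡n j≤k
  ... | t , refl rewrite ℕₚ.m+n∸m≡n j t = arithmetic j t
    where
    arithmetic : ∀ j t → j ℕ.+ suc ((j ℕ.+ t) ℕ.+ suc t) ≡ suc (j ℕ.+ t) ℕ.+ suc (j ℕ.+ t)
    arithmetic = ℕ-solve-∀

  palindrome-odd : ∀ k F → (∀ i j → i ℕ.+ j ≡ suc (k ℕ.+ k) → F i ≡ F j) → Even (sumℤ (suc (k ℕ.+ k)) F)
  palindrome-odd k F symmetric = sumℤ k F , trans (sumℤ-split k k F)
    (cong (λ x → sumℤ k F + x) (trans (sumℤ-reverse k _) (sumℤ-cong k (λ j j≤k → sym (symmetric j _ (mirror-odd j k j≤k))))))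

  palindrome-even : ∀ k F → (∀ i j → i ℕ.+ j ≡ k ℕ.+ k → F i ≡ F j) → Σ ℤ (λ c → sumℤ (k ℕ.+ k) F ≡ F k + (c + c))
  palindrome-even zero    F _         = 0ℤ , sym (ℤₚ.+-identityʳ (F 0))
  palindrome-even (suc k) F symmetric = sumℤ k F , (begin
    sumℤ (suc (k ℕ.+ suc k)) F
      ≡⟨ sumℤ-split k (suc k) F ⟩
    sumℤ k F + sumℤ (suc k) (λ j → F (suc (k ℕ.+ j)))
      ≡⟨ cong (λ x → sumℤ k F + x) (sumℤ-head k _) ⟩
    sumℤ k F + (F (suc (k ℕ.+ 0)) + sumℤ k (λ j → F (suc (k ℕ.+ suc j))))
      ≡⟨ cong₂ (λ a b → sumℤ k F + (F (suc a) + b)) (ℕₚ.+-identityʳ k) upperHalf ⟩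
    sumℤ k F + (F (suc k) + sumℤ k F)
      ≡⟨ regroup (sumℤ k F) (F (suc k)) ⟩
    F (suc k) + (sumℤ k F + sumℤ k F)
      ∎)
    where
    open ≡-Reasoning
    upperHalf : sumℤ k (λ j → F (suc (k ℕ.+ suc j))) ≡ sumℤ k F
    upperHalf = trans (sumℤ-reverse k _) (sumℤ-cong k (λ j j≤k → sym (symmetric j _ (mirror-even j k j≤k))))
    regroup : ∀ s x → s + (x + s) ≡ x + (s + s)
    regroup = solve-∀

  -- The "Frobenius" congruences f(q)² ≡ f(q²) (mod 2): odd coefficients of f² are even and
  -- (f²)_{2k} ≡ f_k² (mod 2).
  square-symmetric : ∀ (f : Series) n i j → i ℕ.+ j ≡ n → f i * f (n ∸ i) ≡ f j * f (n ∸ j)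
  square-symmetric f n i j refl rewrite ℕₚ.m+n∸m≡n i j | ℕₚ.m+n∸n≡m i j = ℤₚ.*-comm (f i) (f j)

  square-odd : ∀ f k → Even ((f ⊛ f) (suc (k ℕ.+ k)))
  square-odd f k with palindrome-odd k (λ i → f i * f (suc (k ℕ.+ k) ∸ i)) (square-symmetric f (suc (k ℕ.+ k)))
  ... | c , e = c , trans (⊛-coeff f f _) e

  square-even : ∀ f k → Σ ℤ (λ c → (f ⊛ f) (k ℕ.+ k) ≡ f k * f k + (c + c))
  square-even f k with palindrome-even k (λ i → f i * f (k ℕ.+ k ∸ i)) (square-symmetric f (k ℕ.+ k))
  ... | c , e = c , trans (⊛-coeff f f _) (trans e (cong (λ t → f k * f t + (c + c)) (ℕₚ.m+n∸n≡m k k)))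

  q^-support : ∀ a x → (q^ a) x ≡ 0ℤ ⊎ a ≡ x
  q^-support zero    zero    = inj₂ refl
  q^-support zero    (suc x) = inj₁ refl
  q^-support (suc a) zero    = inj₁ refl
  q^-support (suc a) (suc x) with q^-support a x
  ... | inj₁ vanishes = inj₁ vanishes
  ... | inj₂ a≡x  = inj₂ (cong suc a≡x)

  sumℤ-support : ∀ {P : Set} n f → (∀ i → f i ≡ 0ℤ ⊎ P) → sumℤ n f ≡ 0ℤ ⊎ P
  sumℤ-support zero    f support = support 0
  sumℤ-support (suc n) f support with sumℤ-support n f support | support (suc n)
  ... | inj₁ s≡0 | inj₁ t≡0 = inj₁ (cong₂ _+_ s≡0 t≡0)
  ... | inj₂ p   | _        = inj₂ p
  ... | inj₁ _   | inj₂ p   = inj₂ p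

  τ-support : ∀ x → τ x ≡ 0ℤ ⊎ Σ ℕ (λ a → suc a ℕ.* suc a ≡ x)
  τ-support x = sumℤ-support x _ (λ k → term k (q^-support (suc k ℕ.* suc k) x))
    where
    term : ∀ k → (q^ (suc k ℕ.* suc k)) x ≡ 0ℤ ⊎ suc k ℕ.* suc k ≡ x →
           sgn (suc k) * (q^ (suc k ℕ.* suc k)) x ≡ 0ℤ ⊎ Σ ℕ (λ a → suc a ℕ.* suc a ≡ x)
    term k (inj₁ vanishes) = inj₁ (trans (cong (sgn (suc k) *_) vanishes) (ℤₚ.*-zeroʳ (sgn (suc k))))
    term k (inj₂ sq)   = inj₂ (k , sq)

  τ-product : ∀ i j → (∀ a b → suc a ℕ.* suc a ≡ i → suc b ℕ.* suc b ≡ j → ⊥) → τ i * τ j ≡ 0ℤ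
  τ-product i j notBoth with τ-support i | τ-support j
  ... | inj₁ τi≡0 | _         = trans (cong (_* τ j) τi≡0) (ℤₚ.*-zeroˡ (τ j))
  ... | inj₂ _    | inj₁ τj≡0 = trans (cong (τ i *_) τj≡0) (ℤₚ.*-zeroʳ (τ i))
  ... | inj₂ (a , a²≡i) | inj₂ (b , b²≡j) = ⊥-elim (notBoth a b a²≡i b²≡j)

  module Mod16 where
    open import Data.Nat.DivMod using (_%_; %-distribˡ-+; %-distribˡ-*; [m+kn]%n≡m%n; m%n<n; m%n%n≡m%n)
    open import Data.Fin using (Fin; toℕ; fromℕ<)
    open import Data.Fin.Properties using (all?; toℕ-fromℕ<)
    open import Relation.Nullary using (¬_)
    open import Relation.Nullary.Decidable using (from-yes; ¬?)

    infix 4 _≡₁₆_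
    _≡₁₆_ : ℕ → ℕ → Set
    x ≡₁₆ y = x % 16 ≡ y % 16

    +-cong₁₆ : ∀ x x′ y y′ → x ≡₁₆ x′ → y ≡₁₆ y′ → x ℕ.+ y ≡₁₆ x′ ℕ.+ y′
    +-cong₁₆ x x′ y y′ x≡x′ y≡y′ =
      trans (%-distribˡ-+ x y 16) (trans (cong₂ (λ a b → (a ℕ.+ b) % 16) x≡x′ y≡y′) (sym (%-distribˡ-+ x′ y′ 16)))

    *-cong₁₆ : ∀ x x′ y y′ → x ≡₁₆ x′ → y ≡₁₆ y′ → x ℕ.* y ≡₁₆ x′ ℕ.* y′
    *-cong₁₆ x x′ y y′ x≡x′ y≡y′ =
      trans (%-distribˡ-* x y 16) (trans (cong₂ (λ a b → (a ℕ.* b) % 16) x≡x′ y≡y′) (sym (%-distribˡ-* x′ y′ 16)))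

    -- the residue of a, as an element of Fin 16 over which properties can be checked exhaustively
    residue : ℕ → Fin 16
    residue a = fromℕ< (m%n<n a 16)

    ρ : ℕ → ℕ
    ρ a = toℕ (residue a)

    square₁₆ : ∀ a → a ℕ.* a ≡₁₆ ρ a ℕ.* ρ a
    square₁₆ a = *-cong₁₆ a (ρ a) a (ρ a) reduce reduce
      where
      reduce : a ≡₁₆ ρ a
      reduce = sym (trans (cong (_% 16) (toℕ-fromℕ< (m%n<n a 16))) (m%n%n≡m%n a 16))

    14≡₁₆ : ∀ n → 16 ℕ.* n ℕ.+ 14 ≡₁₆ 14
    14≡₁₆ n = trans (cong (_% 16) (trans (ℕₚ.+-comm (16 ℕ.* n) 14) (cong (14 ℕ.+_) (ℕₚ.*-comm 16 n))))
                    ([m+kn]%n≡m%n 14 n 16)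

    square-≢ : ∀ a n → a ℕ.* a ≢ 16 ℕ.* n ℕ.+ 14
    square-≢ a n eq = check (residue a) (trans (sym (square₁₆ a)) (trans (cong (_% 16) eq) (14≡₁₆ n)))
      where
      check : ∀ (r : Fin 16) → ¬ ((toℕ r ℕ.* toℕ r) % 16 ≡ 14)
      check = from-yes (all? {n = 16} λ r → ¬? ((toℕ r ℕ.* toℕ r) % 16 ℕ.≟ 14))

    sumOfSquares-≢ : ∀ a b n → a ℕ.* a ℕ.+ b ℕ.* b ≢ 16 ℕ.* n ℕ.+ 14
    sumOfSquares-≢ a b n eq = check (residue a) (residue b)
      (trans (sym (+-cong₁₆ (a ℕ.* a) (ρ a ℕ.* ρ a) (b ℕ.* b) (ρ b ℕ.* ρ b) (square₁₆ a) (square₁₆ b)))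
             (trans (cong (_% 16) eq) (14≡₁₆ n)))
      where
      check : ∀ (r s : Fin 16) → ¬ ((toℕ r ℕ.* toℕ r ℕ.+ toℕ s ℕ.* toℕ s) % 16 ≡ 14)
      check = from-yes (all? {n = 16} λ r → all? {n = 16} λ s → ¬? ((toℕ r ℕ.* toℕ r ℕ.+ toℕ s ℕ.* toℕ s) % 16 ℕ.≟ 14))

    squarePlusDouble-≢ : ∀ a b n → a ℕ.* a ℕ.+ 2 ℕ.* (b ℕ.* b) ≢ 16 ℕ.* n ℕ.+ 14
    squarePlusDouble-≢ a b n eq = check (residue a) (residue b)
      (trans (sym (+-cong₁₆ (a ℕ.* a) (ρ a ℕ.* ρ a) (2 ℕ.* (b ℕ.* b)) (2 ℕ.* (ρ b ℕ.* ρ b))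
                            (square₁₆ a) (*-cong₁₆ 2 2 (b ℕ.* b) (ρ b ℕ.* ρ b) refl (square₁₆ b))))
             (trans (cong (_% 16) eq) (14≡₁₆ n)))
      where
      check : ∀ (r s : Fin 16) → ¬ ((toℕ r ℕ.* toℕ r ℕ.+ 2 ℕ.* (toℕ s ℕ.* toℕ s)) % 16 ≡ 14)
      check = from-yes (all? {n = 16} λ r → all? {n = 16} λ s → ¬? ((toℕ r ℕ.* toℕ r ℕ.+ 2 ℕ.* (toℕ s ℕ.* toℕ s)) % 16 ℕ.≟ 14))

  sumTo-ℤ : ∀ n f → + sumTo n f ≡ sumℤ n (λ i → + f i)
  sumTo-ℤ zero    f = refl
  sumTo-ℤ (suc n) f = trans (ℤₚ.pos-+ (sumTo n f) (f (suc n))) (cong (_+ + f (suc n)) (sumTo-ℤ n f))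

  pbarCube : Series
  pbarCube = pbarSeries ⊛ (pbarSeries ⊛ pbarSeries)

  pbar3≡pbarCube : ∀ n → + pbar3 n ≡ pbarCube n
  pbar3≡pbarCube n = begin
    + pbar3 n
      ≡⟨ sumTo-ℤ n _ ⟩
    sumℤ n (λ a → + sumTo (n ∸ a) (λ b → pbar a ℕ.* pbar b ℕ.* pbar (n ∸ a ∸ b)))
      ≡⟨ sumℤ-cong n (λ a _ → trans (sumTo-ℤ (n ∸ a) _)
           (trans (sumℤ-cong (n ∸ a) (λ b _ → cast a b)) (sumℤ-*ˡ (n ∸ a) (pbarSeries a) _))) ⟩
    sumℤ n (λ a → pbarSeries a * sumℤ (n ∸ a) (λ b → pbarSeries b * pbarSeries (n ∸ a ∸ b)))
      ≡⟨ sumℤ-cong n (λ a _ → cong (pbarSeries a *_) (⊛-coeff pbarSeries pbarSeries (n ∸ a))) ⟨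
    sumℤ n (λ a → pbarSeries a * (pbarSeries ⊛ pbarSeries) (n ∸ a))
      ≡⟨ ⊛-coeff pbarSeries (pbarSeries ⊛ pbarSeries) n ⟨
    pbarCube n
      ∎
    where
    open ≡-Reasoning
    cast : ∀ a b → + (pbar a ℕ.* pbar b ℕ.* pbar (n ∸ a ∸ b)) ≡ pbarSeries a * (pbarSeries b * pbarSeries (n ∸ a ∸ b))
    cast a b = trans (ℤₚ.pos-* (pbar a ℕ.* pbar b) _) (trans (cong (_* pbarSeries (n ∸ a ∸ b)) (ℤₚ.pos-* (pbar a) (pbar b)))
                     (ℤₚ.*-assoc (pbarSeries a) (pbarSeries b) _))

  pbarCube-φ³ : pbarCube ⊛ φ ⊛ φ ⊛ φ ≈ 1S
  pbarCube-φ³ = begin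
    pbarCube ⊛ φ ⊛ φ ⊛ φ
      ≈⟨ regroup pbarSeries φ ⟩
    (pbarSeries ⊛ φ) ⊛ (pbarSeries ⊛ φ) ⊛ (pbarSeries ⊛ φ)
      ≈⟨ ⊛-cong (⊛-cong inverse inverse) inverse ⟩
    1S ⊛ 1S ⊛ 1S
      ≈⟨ ≈-trans (⊛-identityʳ (1S ⊛ 1S)) (⊛-identityʳ 1S) ⟩
    1S
      ∎
    where
    open ≈-Reasoning
    inverse : pbarSeries ⊛ φ ≈ 1S
    inverse = ≈-trans (⊛-comm pbarSeries φ) φ-pbar
    regroup : ∀ p f → p ⊛ (p ⊛ p) ⊛ f ⊛ f ⊛ f ≈ (p ⊛ f) ⊛ (p ⊛ f) ⊛ (p ⊛ f)
    regroup = solve 2 (λ p f → p :* (p :* p) :* f :* f :* f := (p :* f) :* (p :* f) :* (p :* f)) ≈-refl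

  -- The 2-adic expansion of (1 + 2t)⁻³: if p (1 + 2t)³ = 1 then p = E(t) - 32 p t⁵ (21 + 70t + 60t²)
  -- with E(t) = 1 - 6t + 24t² - 80t³ + 240t⁴.
  E : Series → Series
  E t = 1S ⊖ const (+ 6) ⊛ t ⊕ const (+ 24) ⊛ (t ⊛ t) ⊖ const (+ 80) ⊛ (t ⊛ (t ⊛ t)) ⊕ const (+ 240) ⊛ ((t ⊛ t) ⊛ (t ⊛ t))

  correction : Series → Series → Series
  correction p t = p ⊛ (t ⊛ t ⊛ t ⊛ t ⊛ t) ⊛ (const (+ 21) ⊕ const (+ 70) ⊛ t ⊕ const (+ 60) ⊛ (t ⊛ t))

  inverseCube : ∀ p t → p ⊛ (1S ⊕ (t ⊕ t)) ⊛ (1S ⊕ (t ⊕ t)) ⊛ (1S ⊕ (t ⊕ t)) ≈ 1S →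
                p ≈ E t ⊖ const (+ 32) ⊛ correction p t
  inverseCube p t p[1+2t]³≈1 = begin
    p
      ≈⟨ expansion p t ⟩
    E t ⊖ const (+ 32) ⊛ correction p t ⊕ E t ⊛ (p ⊛ θ ⊛ θ ⊛ θ ⊖ 1S)
      ≈⟨ ⊕-congʳ (E t ⊖ const (+ 32) ⊛ correction p t)
           (≈-trans (⊛-congʳ (E t) (λ n → trans (cong (_+ - 1S n) (p[1+2t]³≈1 n)) (ℤₚ.+-inverseʳ (1S n))))
                            (⊛-zeroʳ (E t))) ⟩
    E t ⊖ const (+ 32) ⊛ correction p t ⊕ 0S
      ≈⟨ (λ n → ℤₚ.+-identityʳ _) ⟩
    E t ⊖ const (+ 32) ⊛ correction p t
      ∎
    where
    open ≈-Reasoning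
    θ : Series
    θ = 1S ⊕ (t ⊕ t)
    expansion : ∀ p t → p ≈ E t ⊖ const (+ 32) ⊛ correction p t ⊕ E t ⊛ (p ⊛ (1S ⊕ (t ⊕ t)) ⊛ (1S ⊕ (t ⊕ t)) ⊛ (1S ⊕ (t ⊕ t)) ⊖ 1S)
    expansion = solve 2 (λ p t →
      let θ = :const 1ℤ :+ (t :+ t)
          E = :const 1ℤ :- :const (+ 6) :* t :+ :const (+ 24) :* (t :* t) :- :const (+ 80) :* (t :* (t :* t))
                :+ :const (+ 240) :* ((t :* t) :* (t :* t))
          R = p :* (t :* t :* t :* t :* t) :* (:const (+ 21) :+ :const (+ 70) :* t :+ :const (+ 60) :* (t :* t))
      in p := E :- :const (+ 32) :* R :+ E :* (p :* θ :* θ :* θ :- :const 1ℤ)) ≈-refl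

  -- Consequently p̄₃(N) ≡ E(τ)_N (mod 32), and E(τ)_N ≡ 0 (mod 32) once the low powers of τ vanish
  -- or are even at N.
  pbar3-divisible : ∀ N → 0 < N → τ N ≡ 0ℤ → (τ ⊛ τ) N ≡ 0ℤ → Even ((τ ⊛ (τ ⊛ τ)) N) → Even (((τ ⊛ τ) ⊛ (τ ⊛ τ)) N) →
                    32 ∣ pbar3 N
  pbar3-divisible N@(suc _) _ τ₁≡0 τ₂≡0 (c₃ , τ₃≡2c₃) (c₄ , τ₄≡2c₄) =
    divides ℤ.∣ w ∣ (trans (cong ℤ.∣_∣ pbar3≡32w) (trans (ℤₚ.abs-* (+ 32) w) (ℕₚ.*-comm 32 ℤ.∣ w ∣)))
    where
    open ≡-Reasoning
    R : ℤ
    R = correction pbarCube τ N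
    w : ℤ
    w = - (+ 5) * c₃ + + 15 * c₄ + - R
    coefficient : ∀ c f → (const c ⊛ f) N ≡ c * f N
    coefficient c f = const-⊛ c f N
    E-coefficient : E τ N ≡ - (+ 80 * (c₃ + c₃)) + + 240 * (c₄ + c₄)
    E-coefficient = begin
      0ℤ + - (const (+ 6) ⊛ τ) N + (const (+ 24) ⊛ (τ ⊛ τ)) N + - (const (+ 80) ⊛ (τ ⊛ (τ ⊛ τ))) N
         + (const (+ 240) ⊛ ((τ ⊛ τ) ⊛ (τ ⊛ τ))) N
        ≡⟨ cong₂ _+_ (cong₂ _+_ (cong₂ _+_ (cong (λ x → 0ℤ + - x) (trans (coefficient (+ 6) τ) (cong (+ 6 *_) τ₁≡0)))
                                           (trans (coefficient (+ 24) (τ ⊛ τ)) (cong (+ 24 *_) τ₂≡0)))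
                                (cong -_ (trans (coefficient (+ 80) (τ ⊛ (τ ⊛ τ))) (cong (+ 80 *_) τ₃≡2c₃))))
                     (trans (coefficient (+ 240) ((τ ⊛ τ) ⊛ (τ ⊛ τ))) (cong (+ 240 *_) τ₄≡2c₄)) ⟩
      0ℤ + - (+ 6 * 0ℤ) + + 24 * 0ℤ + - (+ 80 * (c₃ + c₃)) + + 240 * (c₄ + c₄)
        ≡⟨ simplify c₃ c₄ ⟩
      - (+ 80 * (c₃ + c₃)) + + 240 * (c₄ + c₄)
        ∎
      where
      simplify : ∀ a b → 0ℤ + - (+ 6 * 0ℤ) + + 24 * 0ℤ + - (+ 80 * (a + a)) + + 240 * (b + b) ≡ - (+ 80 * (a + a)) + + 240 * (b + b)
      simplify = solve-∀
    pbar3≡32w : + pbar3 N ≡ + 32 * w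
    pbar3≡32w = begin
      + pbar3 N                                                    ≡⟨ pbar3≡pbarCube N ⟩
      pbarCube N                                                   ≡⟨ inverseCube pbarCube τ pbarCube-φ³ N ⟩
      E τ N + - (const (+ 32) ⊛ correction pbarCube τ) N           ≡⟨ cong₂ (λ a b → a + - b) E-coefficient (coefficient (+ 32) _) ⟩
      - (+ 80 * (c₃ + c₃)) + + 240 * (c₄ + c₄) + - (+ 32 * R)      ≡⟨ factor c₃ c₄ R ⟩
      + 32 * w                                                     ∎
      where
      factor : ∀ a b r → - (+ 80 * (a + a)) + + 240 * (b + b) + - (+ 32 * r) ≡ + 32 * (- (+ 5) * a + + 15 * b + - r)
      factor = solve-∀

  -- At N = 16n + 14, which is not of the form a², a² + b² or a² + 2b² with a, b > 0, the coefficients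
  -- of τ and τ² vanish and those of τ³ and τ⁴ are even.
  module Residue14 (n : ℕ) where
    open Mod16

    N k h : ℕ
    N = 16 ℕ.* n ℕ.+ 14
    k = 8 ℕ.* n ℕ.+ 7
    h = 4 ℕ.* n ℕ.+ 3

    N-positive : 0 < N
    N-positive = ℕₚ.≤-trans (s≤s z≤n) (ℕₚ.m≤n+m 14 (16 ℕ.* n))

    N≡k+k : N ≡ k ℕ.+ k
    N≡k+k = arithmetic n
      where
      arithmetic : ∀ n → 16 ℕ.* n ℕ.+ 14 ≡ (8 ℕ.* n ℕ.+ 7) ℕ.+ (8 ℕ.* n ℕ.+ 7)
      arithmetic = ℕ-solve-∀

    k≡2h+1 : k ≡ suc (h ℕ.+ h)
    k≡2h+1 = arithmetic n
      where
      arithmetic : ∀ n → 8 ℕ.* n ℕ.+ 7 ≡ suc ((4 ℕ.* n ℕ.+ 3) ℕ.+ (4 ℕ.* n ℕ.+ 3))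
      arithmetic = ℕ-solve-∀

    -- the coefficients of τ and τ² at N would require N = a² or N = a² + b²
    τ-vanishes : τ N ≡ 0ℤ
    τ-vanishes with τ-support N
    ... | inj₁ τN≡0      = τN≡0
    ... | inj₂ (a , a²≡N) = ⊥-elim (square-≢ (suc a) n a²≡N)

    τ²-vanishes : (τ ⊛ τ) N ≡ 0ℤ
    τ²-vanishes = trans (⊛-coeff τ τ N) (sumℤ-zero N _ (λ i i≤N → τ-product i (N ∸ i) (λ a b a²≡i b²≡N-i →
      sumOfSquares-≢ (suc a) (suc b) n (trans (cong₂ ℕ._+_ a²≡i b²≡N-i) (ℕₚ.m+[n∸m]≡n i≤N)))))

    τ³-even : Even ((τ ⊛ (τ ⊛ τ)) N)
    τ³-even = subst Even (sym (⊛-coeff τ (τ ⊛ τ) N)) (Even-sum N _ term-even)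
      where
      -- τ_i (τ²)_{N-i} is even: by the Frobenius congruence when N - i is odd, and because τ_i τ_h = 0
      -- when N - i = 2h.
      term-even : ∀ i → i ≤ N → Even (τ i * (τ ⊛ τ) (N ∸ i))
      term-even i i≤N with parity (N ∸ i)
      ... | h , inj₂ N-i≡2h+1 with square-odd τ h
      ...   | c , τ²≡2c = τ i * c , trans (cong (λ t → τ i * (τ ⊛ τ) t) N-i≡2h+1)
                                          (trans (cong (τ i *_) τ²≡2c) (ℤₚ.*-distribˡ-+ (τ i) c c))
      term-even i i≤N | h , inj₁ N-i≡2h with square-even τ h
      ... | c , τ²≡τh²+2c = τ i * c , trans (cong (λ t → τ i * (τ ⊛ τ) t) N-i≡2h)
            (trans (cong (τ i *_) τ²≡τh²+2c) (absorb (τ i) (τ h) c (τ-product i h notSquares)))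
        where
        notSquares : ∀ a b → suc a ℕ.* suc a ≡ i → suc b ℕ.* suc b ≡ h → ⊥
        notSquares a b a²≡i b²≡h = squarePlusDouble-≢ (suc a) (suc b) n
          (trans (cong₂ (λ x y → x ℕ.+ 2 ℕ.* y) a²≡i b²≡h)
          (trans (cong (i ℕ.+_) (cong (h ℕ.+_) (ℕₚ.+-identityʳ h)))
          (trans (cong (i ℕ.+_) (sym N-i≡2h)) (ℕₚ.m+[n∸m]≡n i≤N))))
        absorb : ∀ x y c → x * y ≡ 0ℤ → x * (y * y + (c + c)) ≡ x * c + x * c
        absorb x y c xy≡0 = trans (expand x y c) (trans (cong (λ t → t * y + (x * c + x * c)) xy≡0) (zero+ y (x * c + x * c)))
          where
          expand : ∀ x y c → x * (y * y + (c + c)) ≡ x * y * y + (x * c + x * c)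
          expand = solve-∀
          zero+ : ∀ y z → 0ℤ * y + z ≡ z
          zero+ = solve-∀

    -- (τ⁴)_{2k} ≡ ((τ²)_k)² (mod 2), and (τ²)_k is even because k is odd.
    τ⁴-even : Even (((τ ⊛ τ) ⊛ (τ ⊛ τ)) N)
    τ⁴-even with square-even (τ ⊛ τ) k | square-odd τ h
    ... | c , τ⁴≡ | d , τ²≡2d = (d + d) * d + c ,
      trans (cong ((τ ⊛ τ) ⊛ (τ ⊛ τ)) N≡k+k)
      (trans τ⁴≡ (trans (cong (λ t → t * t + (c + c)) (trans (cong (τ ⊛ τ) k≡2h+1) τ²≡2d)) (regroup d c)))
      where
      regroup : ∀ d c → (d + d) * (d + d) + (c + c) ≡ ((d + d) * d + c) + ((d + d) * d + c)
      regroup = solve-∀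

open import Defs using (pbar3)
open import Data.Nat using (ℕ; _+_; _*_)
open import Data.Nat.Divisibility using (_∣_)
open Proof using (pbar3-divisible; module Residue14)

theorem2p8 : ∀ (n : ℕ) → 32 ∣ pbar3 (16 * n + 14)
theorem2p8 n = pbar3-divisible N N-positive τ-vanishes τ²-vanishes τ³-even τ⁴-even
  where open Residue14 n
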